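{- Let $C$ be a necklace of length $L$. Then $C$ is a Maker win and $\tau_M(C)=1+\lceil\log_2(L)\rceil$. Moreover, $J_1(\mathcal S,C)$ does not hold.
   Context: A marked hypergraph $H$: finite nonempty $V(H)$, edge set $E(H)$ of nonempty subsets of $V(H)$, marked set $M(H)\subseteq V(H)$. Subhypergraph $X$: $V(X)\subseteq V(H)$, $E(X)\subseteq E(H)$, $M(X)=V(X)\cap M(H)$. $H^{+x}$ marks non-marked $x$; $H^{ -y}$ deletes $y$ and all edges containing it. Trivial Maker win: some edge $e$ with $|e\setminus M(H)|\le1$. Maker win (recursive): if $|V(H)\setminus M(H)|\le1$, iff trivial Maker win; otherwise iff some non-marked $x$ has $H^{+x-y}$ a Maker win for all non-marked $y\ne x$. $\tau_M(H)$: if trivial Maker win, $\min_e|e\setminus M(H)|$; if not and $|V(H)\setminus M(H)|\le1$, $\infty$; otherwise $1+\min_x\max_y\tau_M(H^{+x-y})$ over non-marked $x$ and non-marked $y\ne x$. $ab$-path of length $L\ge1$: edges $e_1,\dots,e_L$ (3-sets), vertex set $\bigcup e_i$, $|e_i\cap e_{i+1}|=1$, $e_i\cap e_j=\varnothing$ for $|i-j|\ge2$, $a\ne b$, $a\in e_1\setminus\bigcup_{i\ge2}e_i$, $b\in e_L\setminus\bigcup_{i<L}e_i$. $a$-cycle of length $L\ge2$: edges $e_1,\dots,e_L$, vertex set $\bigcup e_i$, $a\in e_1\cap e_L$, $a\notin e_i$ for $1<i<L$; if $L=2$, $|e_1\cap e_2|=2$; if $L\ge3$, $|e_i\cap e_{i+1}|=1$,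 $e_1\cap e_L=\{a\}$, other pairs with $|i-j|\ge2$ disjoint. A necklace is an $a$-cycle whose only marked vertex is $a$. An $x$-snake is an $xm$-path of positive length with $m$ marked. $\mathcal S$: all pointed $(S,x)$ ($x$ non-marked) with $S$ an $x$-snake having exactly one marked vertex; $x\mathcal S(H)$: subhypergraphs $X\ni x$ with $(X,x)$ isomorphic (preserving edges, marks, point) to a member of $\mathcal S$. $\mathrm{Int}_H(\mathcal X)$: non-marked vertices of $H$ lying in every member of $\mathcal X$. $J_1(\mathcal S,H)$: for every $x\in V(H)\setminus M(H)$, $\mathrm{Int}_{H^{+x}}(x\mathcal S(H))\ne\varnothing$. -}

module Defs where

open import Data.Nat using (ℕ; zero; suc; _+_; _≤_; _<_; _≤ᵇ_)
open import Data.Nat as ℕ using ()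
open import Data.Bool using (Bool; true; false; if_then_else_)
open import Data.Maybe using (Maybe; just; nothing)
open import Data.Fin using (Fin)
open import Data.Fin.Subset
  using (Subset; _∈_; _∉_; _⊆_; ∁; _∩_; _─_; _-_; ∣_∣; ⁅_⁆; ⊥; outside)
open import Data.Fin.Subset.Properties using (_∈?_)
open import Data.List using (List; []; _∷_; map; filter; foldr; allFin)
open import Data.Bool.ListAction using (any)
open import Data.List.Membership.Propositional using () renaming (_∈_ to _∈ₗ_)
open import Data.Product using (Σ; ∃; ∃-syntax; _×_; _,_)
open import Relation.Nullary using (¬_; does)
open import Relation.Binary.PropositionalEquality using (_≡_; _≢_)
open import Function using (_⇔_)
open import Data.Vec using (_[_]≔_)

-- Marked hypergraphs on the ambient vertex type  Fin n.
-- V : vertex set, E : edges (a list of subsets; read as a set),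
-- M : marked vertices.

record MH (n : ℕ) : Set where
  constructor mkMH
  field
    V : Subset n
    E : List (Subset n)
    M : Subset n
open MH public

WF : ∀ {n} → MH n → Set
WF H = (∃[ v ] v ∈ V H)
     × (∀ e → e ∈ₗ E H → ∃[ v ] v ∈ e)
     × (∀ e → e ∈ₗ E H → e ⊆ V H)
     × (M H ⊆ V H)

U : ∀ {n} → MH n → Subset n
U H = V H ─ M H

mark : ∀ {n} → Fin n → MH n → MH n
mark x H = mkMH (V H) (E H) (M H [ x ]≔ Data.Bool.true)
  where import Data.Bool

del : ∀ {n} → Fin n → MH n → MH n
del y H = mkMH (V H - y) (filter (λ e → Relation.Nullary.¬? (y ∈? e)) (E H)) (M H - y)
  where import Relation.Nullary

TrivialWin : ∀ {n} → MH n → Set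
TrivialWin H = ∃[ e ] (e ∈ₗ E H × ∣ e ─ M H ∣ ≤ 1)

-- Maker win (the recursive definition, as an inductive predicate;
-- recursion is well-founded since |V \ M| drops by 2 in each step)
data MakerWin {n : ℕ} : MH n → Set where
  base : ∀ {H} → ∣ U H ∣ ≤ 1 → TrivialWin H → MakerWin H
  step : ∀ {H} → 2 ≤ ∣ U H ∣ → (x : Fin n) → x ∈ U H →
         (∀ y → y ∈ U H → y ≢ x → MakerWin (del y (mark x H))) →
         MakerWin H

-- τ_M, valued in ℕ ∪ {∞} = Maybe ℕ  (nothing = ∞)

ℕ∞ : Set
ℕ∞ = Maybe ℕ

min∞ : ℕ∞ → ℕ∞ → ℕ∞
min∞ nothing b = b
min∞ (just a) nothing = just a
min∞ (just a) (just b) = just (ℕ._⊓_ a b)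

max∞ : ℕ∞ → ℕ∞ → ℕ∞
max∞ nothing b = nothing
max∞ (just a) nothing = nothing
max∞ (just a) (just b) = just (ℕ._⊔_ a b)

suc∞ : ℕ∞ → ℕ∞
suc∞ nothing = nothing
suc∞ (just a) = just (suc a)

minOver : ∀ {A : Set} → List A → (A → ℕ∞) → ℕ∞
minOver xs f = foldr (λ a r → min∞ (f a) r) nothing xs

-- maximum of a list (only used on nonempty lists)
maxOver : ∀ {A : Set} → List A → (A → ℕ∞) → ℕ∞
maxOver xs f = foldr (λ a r → max∞ (f a) r) (just 0) xs

elems : ∀ {n} → Subset n → List (Fin n)
elems {n} p = filter (λ x → x ∈? p) (allFin n)

trivialB : ∀ {n} → MH n → Bool
trivialB H = any (λ e → ∣ e ─ M H ∣ ≤ᵇ 1) (E H)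

-- τ_M with fuel (fuel = |V \ M| suffices: each move pair removes
-- two non-marked vertices)
mutual
  tauF : ∀ {n} → ℕ → MH n → ℕ∞
  tauF f H with trivialB H
  ... | true  = minOver (E H) (λ e → just ∣ e ─ M H ∣)
  ... | false with ∣ U H ∣ ≤ᵇ 1
  ...   | true  = nothing
  ...   | false = tauStep f H

  tauStep : ∀ {n} → ℕ → MH n → ℕ∞
  tauStep zero H = nothing
  tauStep (suc f) H =
    suc∞ (minOver (elems (U H)) (λ x →
            maxOver (elems (U H - x)) (λ y → tauF f (del y (mark x H)))))

τM : ∀ {n} → MH n → ℕ∞
τM H = tauF ∣ U H ∣ H

-- paths, cycles, necklaces, snakes.  Edges are indexed e 1, …, e L.

IsPath : ∀ {n} → MH n → (ℕ → Subset n) → ℕ → Fin n → Fin n → Set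
IsPath X e L a b =
    1 ≤ L
  × (∀ i → 1 ≤ i → i ≤ L → ∣ e i ∣ ≡ 3)
  × (∀ v → (v ∈ V X) ⇔ (∃[ i ] (1 ≤ i × i ≤ L × v ∈ e i)))
  × (∀ f → (f ∈ₗ E X) ⇔ (∃[ i ] (1 ≤ i × i ≤ L × f ≡ e i)))
  × (∀ i → 1 ≤ i → i < L → ∣ e i ∩ e (suc i) ∣ ≡ 1)
  × (∀ i j → 1 ≤ i → i + 2 ≤ j → j ≤ L → e i ∩ e j ≡ ⊥)
  × a ≢ b
  × a ∈ e 1 × (∀ i → 2 ≤ i → i ≤ L → a ∉ e i)
  × b ∈ e L × (∀ i → 1 ≤ i → i < L → b ∉ e i)

IsCycle : ∀ {n} → MH n → (ℕ → Subset n) → ℕ → Fin n → Set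
IsCycle X e L a =
    2 ≤ L
  × (∀ i → 1 ≤ i → i ≤ L → ∣ e i ∣ ≡ 3)
  × (∀ v → (v ∈ V X) ⇔ (∃[ i ] (1 ≤ i × i ≤ L × v ∈ e i)))
  × (∀ f → (f ∈ₗ E X) ⇔ (∃[ i ] (1 ≤ i × i ≤ L × f ≡ e i)))
  × a ∈ e 1 × a ∈ e L
  × (∀ i → 1 < i → i < L → a ∉ e i)
  × (L ≡ 2 → ∣ e 1 ∩ e 2 ∣ ≡ 2)
  × (3 ≤ L →
        (∀ i → 1 ≤ i → i < L → ∣ e i ∩ e (suc i) ∣ ≡ 1)
      × (e 1 ∩ e L ≡ ⁅ a ⁆)
      × (∀ i j → 1 ≤ i → i + 2 ≤ j → j ≤ L → ¬ (i ≡ 1 × j ≡ L) →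
           e i ∩ e j ≡ ⊥))

IsNecklace : ∀ {n} → MH n → (ℕ → Subset n) → ℕ → Fin n → Set
IsNecklace C e L a =
  IsCycle C e L a × (∀ v → v ∈ V C → (v ∈ M C ⇔ v ≡ a))

IsSub : ∀ {n} → MH n → MH n → Set
IsSub X H =
  WF X × V X ⊆ V H × (∀ f → f ∈ₗ E X → f ∈ₗ E H) × M X ≡ V X ∩ M H

IsSnake1 : ∀ {n} → MH n → Fin n → Set
IsSnake1 X x =
  x ∉ M X ×
  ∃[ L ] ∃[ e ] ∃[ m ]
    ( IsPath X e L x m × m ∈ M X
    × (∀ v → v ∈ V X → v ∈ M X → v ≡ m))

InXS : ∀ {n} → MH n → Fin n → MH n → Set
InXS H x X = IsSub X H × x ∈ V X × IsSnake1 X x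

J1 : ∀ {n} → MH n → Set
J1 H = ∀ x → x ∈ U H →
         ∃[ v ] (v ∈ U (mark x H) × (∀ X → InXS H x X → v ∈ V X))

-- Number the edges of the necklace e 1, …, e L, let joint t be the vertex shared by e t and
-- e (t + 1) (joint 0 = joint L = a), and call a run of present edges between two marked joints
-- a marked arc.  Maker turns an arc of length m into a win within 1 + ⌈log₂ m⌉ moves: he marks
-- its middle joint, and Breaker's vertex can cut only one of the two halves; an arc of length 1
-- is a trivial win.  Breaker keeps every marked arc of length at least k while k only halves:
-- against a joint he cuts the edge next to it on the side of the nearer marked joint, against
-- the third (pendant) vertex of an edge he kills that edge.  While k ≥ 2 every edge has two
-- free vertices, so τ_M ≥ 1 + ⌈log₂ k⌉; the whole necklace is an arc of length L.  Finally, the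
-- edge e 1 and the path e 2, …, e L are two snakes from joint 1 that meet only in joint 1 and a,
-- so J₁ fails.

module Submission where

open import Defs
open import Data.Nat
  using (ℕ; zero; suc; _+_; _∸_; _≤_; _<_; _≤ᵇ_; z≤n; s≤s; ⌈_/2⌉; ⌊_/2⌋; pred; _≟_; _≤?_; _<?_)
open import Data.Nat.Properties
open import Data.Nat.Induction using (<-rec)
open import Algebra.Properties.CommutativeSemigroup +-commutativeSemigroup
  using (interchange; xy∙z≈xz∙y; x∙yz≈y∙xz)
open import Data.Nat.Logarithm using (⌈log₂_⌉; ⌈log₂⌉-mono-≤; ⌈log₂⌈n/2⌉⌉≡⌈log₂n⌉∸1)
open import Data.Fin using (Fin; zero; suc) renaming (_≟_ to _≟ᶠ_)
open import Data.Fin.Subset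
  using (Subset; _∈_; _∉_; _⊆_; _∩_; _∪_; _─_; _-_; ∣_∣; ⁅_⁆; ⋃; Nonempty) renaming (⊥ to ∅)
open import Data.Fin.Subset.Properties
  using ( _∈?_; x∈p∩q⁺; x∈p∩q⁻; x∈p∪q⁻; x∈p∪q⁺; x∈p∧x∉q⇒x∈p─q; x∈p∧x≢y⇒x∈p-y
        ; p⊆q⇒∣p∣≤∣q∣; p⊂q⇒∣p∣<∣q∣; x∈⁅x⁆; x∈⁅y⁆⇒x≡y; ∣⁅x⁆∣≡1; ∉⊥; nonempty?; Empty-unique; ∣⊥∣≡0
        ; x∈p⇒∣p-x∣<∣p∣; drop-there)
open import Data.Bool using (true; false) renaming (_≟_ to _≟ᵇ_)
open import Data.Maybe using (just; nothing)
open import Data.Vec using ([]; _∷_; here; there; _[_]≔_)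
open import Data.Vec.Properties using (≡-dec)
open import Data.List using (List; []; _∷_; applyUpTo)
open import Data.List.Membership.Propositional using (find; lose) renaming (_∈_ to _∈ₗ_)
open import Data.List.Membership.Propositional.Properties
  using (∈-filter⁺; ∈-filter⁻; ∈-allFin; ∈-applyUpTo⁺; ∈-applyUpTo⁻)
import Data.List.Relation.Unary.Any as Any
open import Data.List.Relation.Unary.Any.Properties using (any⁺; any⁻)
open import Data.Product using (∃-syntax; _×_; _,_; proj₁; proj₂)
open import Data.Sum using (_⊎_; inj₁; inj₂)
open import Relation.Binary.Definitions using (tri<; tri≈; tri>)
open import Data.Empty using (⊥; ⊥-elim)
open import Data.Unit using (⊤; tt)
open import Relation.Nullary using (¬_; Dec; yes; no; ¬?; _because_)
open import Relation.Nullary.Decidable using (_×-dec_; _→-dec_; map′)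
open import Relation.Unary using (Decidable)
open import Relation.Nullary.Reflects using (Reflects; ofʸ; ofⁿ; fromEquivalence)
open import Relation.Binary.PropositionalEquality using (_≡_; _≢_; refl; sym; trans; cong; subst)
open import Function using (_∘_; _⇔_; mk⇔; Equivalence)

private variable
  n : ℕ
  p : Subset n

x∈p─q⁻ : ∀ {x : Fin n} (p q : Subset n) → x ∈ p ─ q → x ∈ p × x ∉ q
x∈p─q⁻ (true ∷ p) (false ∷ q) here = here , λ ()
x∈p─q⁻ {x = zero} (false ∷ p) (true ∷ q) ()
x∈p─q⁻ {x = zero} (false ∷ p) (false ∷ q) ()
x∈p─q⁻ (_ ∷ p) (_ ∷ q) (there x∈) =
  let x∈p , x∉q = x∈p─q⁻ p q x∈ in there x∈p , x∉q ∘ drop-there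

x∈p-y⁻ : ∀ {x y : Fin n} (p : Subset n) → x ∈ p - y → x ∈ p × x ≢ y
x∈p-y⁻ {y = y} p x∈ =
  let x∈p , x∉y = x∈p─q⁻ p ⁅ y ⁆ x∈ in x∈p , λ { refl → x∉y (x∈⁅x⁆ y) }

x∈p[x]≔true : ∀ (x : Fin n) (p : Subset n) → x ∈ p [ x ]≔ true
x∈p[x]≔true zero    (_ ∷ p) = here
x∈p[x]≔true (suc x) (_ ∷ p) = there (x∈p[x]≔true x p)

x∈p⇒x∈p[y]≔true : ∀ {x : Fin n} (y : Fin n) (p : Subset n) → x ∈ p → x ∈ p [ y ]≔ true
x∈p⇒x∈p[y]≔true zero    (_ ∷ p) here      = here
x∈p⇒x∈p[y]≔true zero    (_ ∷ p) (there x∈) = there x∈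
x∈p⇒x∈p[y]≔true (suc y) (_ ∷ p) here      = here
x∈p⇒x∈p[y]≔true (suc y) (_ ∷ p) (there x∈) = there (x∈p⇒x∈p[y]≔true y p x∈)

x∈p[y]≔true⇒x∈p : ∀ {x : Fin n} (y : Fin n) (p : Subset n) →
                  x ∈ p [ y ]≔ true → x ≢ y → x ∈ p
x∈p[y]≔true⇒x∈p zero    (_ ∷ p)    here       x≢y = ⊥-elim (x≢y refl)
x∈p[y]≔true⇒x∈p zero    (_ ∷ p)    (there x∈) _   = there x∈
x∈p[y]≔true⇒x∈p (suc y) (true ∷ p) here       _   = here
x∈p[y]≔true⇒x∈p (suc y) (_ ∷ p)    (there x∈) x≢y =
  there (x∈p[y]≔true⇒x∈p y p x∈ (x≢y ∘ cong suc))

∣p∪q∣≤∣p∣+∣q∣ : ∀ (p q : Subset n) → ∣ p ∪ q ∣ ≤ ∣ p ∣ + ∣ q ∣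
∣p∪q∣≤∣p∣+∣q∣ []          []          = z≤n
∣p∪q∣≤∣p∣+∣q∣ (true ∷ p)  (true ∷ q)  = s≤s (≤-trans (∣p∪q∣≤∣p∣+∣q∣ p q) (+-monoʳ-≤ ∣ p ∣ (n≤1+n _)))
∣p∪q∣≤∣p∣+∣q∣ (true ∷ p)  (false ∷ q) = s≤s (∣p∪q∣≤∣p∣+∣q∣ p q)
∣p∪q∣≤∣p∣+∣q∣ (false ∷ p) (true ∷ q)  =
  ≤-trans (s≤s (∣p∪q∣≤∣p∣+∣q∣ p q)) (≤-reflexive (sym (+-suc ∣ p ∣ ∣ q ∣)))
∣p∪q∣≤∣p∣+∣q∣ (false ∷ p) (false ∷ q) = ∣p∪q∣≤∣p∣+∣q∣ p q

suc≤∣p∣ : ∀ {x k} → x ∈ p → k ≤ ∣ p - x ∣ → suc k ≤ ∣ p ∣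
suc≤∣p∣ x∈p k≤ = ≤-<-trans k≤ (x∈p⇒∣p-x∣<∣p∣ x∈p)

1≤∣p∣ : ∀ {x} → x ∈ p → 1 ≤ ∣ p ∣
1≤∣p∣ x∈p = suc≤∣p∣ x∈p z≤n

2≤∣p∣ : ∀ {x y} → x ∈ p → y ∈ p → x ≢ y → 2 ≤ ∣ p ∣
2≤∣p∣ x∈p y∈p x≢y = suc≤∣p∣ x∈p (1≤∣p∣ (x∈p∧x≢y⇒x∈p-y y∈p (x≢y ∘ sym)))

3≤∣p∣ : ∀ {x y z} → x ∈ p → y ∈ p → z ∈ p → x ≢ y → x ≢ z → y ≢ z → 3 ≤ ∣ p ∣
3≤∣p∣ x∈p y∈p z∈p x≢y x≢z y≢z =
  suc≤∣p∣ x∈p (2≤∣p∣ (x∈p∧x≢y⇒x∈p-y y∈p (x≢y ∘ sym)) (x∈p∧x≢y⇒x∈p-y z∈p (x≢z ∘ sym)) y≢z)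

4≤∣p∣ : ∀ {x y z w} → x ∈ p → y ∈ p → z ∈ p → w ∈ p →
        x ≢ y → x ≢ z → x ≢ w → y ≢ z → y ≢ w → z ≢ w → 4 ≤ ∣ p ∣
4≤∣p∣ x∈p y∈p z∈p w∈p x≢y x≢z x≢w y≢z y≢w z≢w =
  suc≤∣p∣ x∈p (3≤∣p∣ (x∈p∧x≢y⇒x∈p-y y∈p (x≢y ∘ sym)) (x∈p∧x≢y⇒x∈p-y z∈p (x≢z ∘ sym))
                     (x∈p∧x≢y⇒x∈p-y w∈p (x≢w ∘ sym)) y≢z y≢w z≢w)

∣p∣≤1⇒≡ : ∀ {x y} → ∣ p ∣ ≤ 1 → x ∈ p → y ∈ p → x ≡ y
∣p∣≤1⇒≡ {x = x} {y = y} ∣p∣≤1 x∈p y∈p with x ≟ᶠ y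
... | yes x≡y = x≡y
... | no  x≢y = ⊥-elim (<⇒≱ (2≤∣p∣ x∈p y∈p x≢y) ∣p∣≤1)

∣p∣≤2⇒≡ : ∀ {x y z} → ∣ p ∣ ≤ 2 → x ∈ p → y ∈ p → z ∈ p → x ≢ y → z ≡ x ⊎ z ≡ y
∣p∣≤2⇒≡ {x = x} {y = y} {z = z} ∣p∣≤2 x∈p y∈p z∈p x≢y with z ≟ᶠ x | z ≟ᶠ y
... | yes z≡x | _       = inj₁ z≡x
... | no  _   | yes z≡y = inj₂ z≡y
... | no  z≢x | no  z≢y =
  ⊥-elim (<⇒≱ (3≤∣p∣ x∈p y∈p z∈p x≢y (z≢x ∘ sym) (z≢y ∘ sym)) ∣p∣≤2)

∣p∣≡3⇒≡ : ∀ {x y z w} → ∣ p ∣ ≡ 3 → x ∈ p → y ∈ p → z ∈ p → w ∈ p →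
          x ≢ y → x ≢ z → y ≢ z → w ≡ x ⊎ w ≡ y ⊎ w ≡ z
∣p∣≡3⇒≡ {x = x} {y = y} {z = z} {w = w} ∣p∣≡3 x∈p y∈p z∈p w∈p x≢y x≢z y≢z
  with w ≟ᶠ x | w ≟ᶠ y | w ≟ᶠ z
... | yes w≡x | _       | _       = inj₁ w≡x
... | no  _   | yes w≡y | _       = inj₂ (inj₁ w≡y)
... | no  _   | no  _   | yes w≡z = inj₂ (inj₂ w≡z)
... | no  w≢x | no  w≢y | no  w≢z =
  ⊥-elim (<⇒≱ (4≤∣p∣ x∈p y∈p z∈p w∈p x≢y x≢z (w≢x ∘ sym) y≢z (w≢y ∘ sym) (w≢z ∘ sym))
              (≤-reflexive ∣p∣≡3))

∣p∣≤1+∣p-x∣ : ∀ (p : Subset n) x → ∣ p ∣ ≤ suc ∣ p - x ∣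
∣p∣≤1+∣p-x∣ p x = begin
  ∣ p ∣                   ≤⟨ p⊆q⇒∣p∣≤∣q∣ p⊆x∪p-x ⟩
  ∣ ⁅ x ⁆ ∪ (p - x) ∣     ≤⟨ ∣p∪q∣≤∣p∣+∣q∣ ⁅ x ⁆ (p - x) ⟩
  ∣ ⁅ x ⁆ ∣ + ∣ p - x ∣   ≡⟨ cong (_+ ∣ p - x ∣) (∣⁅x⁆∣≡1 x) ⟩
  suc ∣ p - x ∣           ∎
  where
  open ≤-Reasoning
  p⊆x∪p-x : p ⊆ ⁅ x ⁆ ∪ (p - x)
  p⊆x∪p-x {y} y∈p with y ≟ᶠ x
  ... | yes refl = x∈p∪q⁺ (inj₁ (x∈⁅x⁆ x))
  ... | no  y≢x  = x∈p∪q⁺ (inj₂ (x∈p∧x≢y⇒x∈p-y y∈p y≢x))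

1≤∣p∣⇒nonempty : ∀ {p : Subset n} → 1 ≤ ∣ p ∣ → Nonempty p
1≤∣p∣⇒nonempty {n} {p} 1≤∣p∣ with nonempty? p
... | yes ne = ne
... | no ¬ne = ⊥-elim (<⇒≱ 1≤∣p∣ (≤-reflexive (trans (cong ∣_∣ (Empty-unique ¬ne)) (∣⊥∣≡0 n))))

2≤∣p∣⇒another : ∀ {p : Subset n} → 2 ≤ ∣ p ∣ → ∀ x → ∃[ y ] (y ∈ p × y ≢ x)
2≤∣p∣⇒another {p = p} 2≤∣p∣ x =
  let y , y∈p-x = 1≤∣p∣⇒nonempty (≤-pred (≤-trans 2≤∣p∣ (∣p∣≤1+∣p-x∣ p x)))
  in y , x∈p-y⁻ p y∈p-x

3≤∣p∣⇒third : ∀ {p : Subset n} → 3 ≤ ∣ p ∣ → ∀ x y → ∃[ z ] (z ∈ p × z ≢ x × z ≢ y)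
3≤∣p∣⇒third {p = p} 3≤∣p∣ x y =
  let z , z∈p-x , z≢y = 2≤∣p∣⇒another (≤-pred (≤-trans 3≤∣p∣ (∣p∣≤1+∣p-x∣ p x))) y
      z∈p , z≢x = x∈p-y⁻ p z∈p-x
  in z , z∈p , z≢x , z≢y

u∈p∧v∉p⇒u≢v : ∀ {u v} → u ∈ p → v ∉ p → u ≢ v
u∈p∧v∉p⇒u≢v u∈p v∉p refl = v∉p u∈p

1≤∣f─M∣ : ∀ {f M : Subset n} {c} → c ∈ f → c ∉ M → 1 ≤ ∣ f ─ M ∣
1≤∣f─M∣ c∈f c∉M = 1≤∣p∣ (x∈p∧x∉q⇒x∈p─q c∈f c∉M)

2≤∣f─M∣ : ∀ {f M : Subset n} {c d} → c ∈ f → d ∈ f → c ≢ d → c ∉ M → d ∉ M → 2 ≤ ∣ f ─ M ∣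
2≤∣f─M∣ c∈f d∈f c≢d c∉M d∉M = 2≤∣p∣ (x∈p∧x∉q⇒x∈p─q c∈f c∉M) (x∈p∧x∉q⇒x∈p─q d∈f d∉M) c≢d

∣f─M∣≤1 : ∀ {f M : Subset n} {u w} → ∣ f ∣ ≡ 3 → u ∈ f → w ∈ f → u ≢ w → u ∈ M → w ∈ M →
          ∣ f ─ M ∣ ≤ 1
∣f─M∣≤1 {f = f} {M} {u} {w} ∣f∣≡3 u∈f w∈f u≢w u∈M w∈M with ∣ f ─ M ∣ ≤? 1
... | yes ≤1 = ≤1
... | no  ≰1 =
  let c , c∈ , _ = 2≤∣p∣⇒another (≰⇒> ≰1) u
      d , d∈ , d≢c = 2≤∣p∣⇒another (≰⇒> ≰1) c
      c∈f , c∉M = x∈p─q⁻ f M c∈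
      d∈f , d∉M = x∈p─q⁻ f M d∈
  in ⊥-elim (<⇒≱ (4≤∣p∣ u∈f w∈f c∈f d∈f u≢w (u∈p∧v∉p⇒u≢v u∈M c∉M) (u∈p∧v∉p⇒u≢v u∈M d∉M)
                        (u∈p∧v∉p⇒u≢v w∈M c∉M) (u∈p∧v∉p⇒u≢v w∈M d∉M) (d≢c ∘ sym))
                 (≤-reflexive ∣f∣≡3))

x∈⋃⁻ : ∀ {x : Fin n} fs → x ∈ ⋃ fs → ∃[ f ] (f ∈ₗ fs × x ∈ f)
x∈⋃⁻ []       x∈ = ⊥-elim (∉⊥ x∈)
x∈⋃⁻ (f ∷ fs) x∈ with x∈p∪q⁻ f (⋃ fs) x∈
... | inj₁ x∈f  = f , Any.here refl , x∈f
... | inj₂ x∈fs = let g , g∈ , x∈g = x∈⋃⁻ fs x∈fs in g , Any.there g∈ , x∈g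

x∈⋃⁺ : ∀ {x : Fin n} {f} fs → f ∈ₗ fs → x ∈ f → x ∈ ⋃ fs
x∈⋃⁺ (_ ∷ fs) (Any.here refl) x∈f = x∈p∪q⁺ (inj₁ x∈f)
x∈⋃⁺ (_ ∷ fs) (Any.there f∈)  x∈f = x∈p∪q⁺ (inj₂ (x∈⋃⁺ fs f∈ x∈f))

pick : Fin n → Subset n → Fin n
pick default p with nonempty? p
... | yes (x , _) = x
... | no  _       = default

pick∈ : ∀ default {p : Subset n} → Nonempty p → pick default p ∈ p
pick∈ default {p} ne with nonempty? p
... | yes (_ , x∈p) = x∈p
... | no  empty     = ⊥-elim (empty ne)

play : Fin n → Fin n → MH n → MH n
play x y H = del y (mark x H)

module _ (H : MH n) where

  U⁻ : ∀ {v} → v ∈ U H → v ∈ V H × v ∉ M H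
  U⁻ = x∈p─q⁻ (V H) (M H)

  U⁺ : ∀ {v} → v ∈ V H → v ∉ M H → v ∈ U H
  U⁺ = x∈p∧x∉q⇒x∈p─q

  module _ (x y : Fin n) where

    E-play⁻ : ∀ {f} → f ∈ₗ E (play x y H) → f ∈ₗ E H × y ∉ f
    E-play⁻ = ∈-filter⁻ (λ f → ¬? (y ∈? f)) {xs = E (mark x H)}

    E-play⁺ : ∀ {f} → f ∈ₗ E H → y ∉ f → f ∈ₗ E (play x y H)
    E-play⁺ = ∈-filter⁺ (λ f → ¬? (y ∈? f))

    V-play⁻ : ∀ {v} → v ∈ V (play x y H) → v ∈ V H
    V-play⁻ = proj₁ ∘ x∈p-y⁻ (V H)

    M-play⁺ : ∀ {v} → v ∈ M H → v ≢ y → v ∈ M (play x y H)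
    M-play⁺ v∈M = x∈p∧x≢y⇒x∈p-y (x∈p⇒x∈p[y]≔true x (M H) v∈M)

    x∈M-play : x ≢ y → x ∈ M (play x y H)
    x∈M-play = x∈p∧x≢y⇒x∈p-y (x∈p[x]≔true x (M H))

    M-play⁻ : ∀ {v} → v ∈ M (play x y H) → v ≢ x → v ∈ M H
    M-play⁻ v∈M = x∈p[y]≔true⇒x∈p x (M H) (proj₁ (x∈p-y⁻ _ v∈M))

    U-play⁻ : ∀ {v} → v ∈ U (play x y H) → v ∈ U H × v ≢ x × v ≢ y
    U-play⁻ {v} v∈U with x∈p─q⁻ (V (play x y H)) (M (play x y H)) v∈U
    ... | v∈V , v∉M with x∈p-y⁻ (V H) v∈V | v ≟ᶠ x
    ...   | _   , v≢y | yes refl = ⊥-elim (v∉M (x∈M-play v≢y))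
    ...   | v∈V′ , v≢y | no v≢x  = U⁺ v∈V′ (λ v∈M → v∉M (M-play⁺ v∈M v≢y)) , v≢x , v≢y

    ∣U-play∣<∣U∣ : x ∈ U H → ∣ U (play x y H) ∣ < ∣ U H ∣
    ∣U-play∣<∣U∣ x∈U =
      p⊂q⇒∣p∣<∣q∣ ((proj₁ ∘ U-play⁻) , x , x∈U , λ x∈U′ → proj₁ (proj₂ (U-play⁻ x∈U′)) refl)

EdgesInside : MH n → Set
EdgesInside H = ∀ f → f ∈ₗ E H → f ⊆ V H

EdgesInside-play : ∀ {H : MH n} x y → EdgesInside H → EdgesInside (play x y H)
EdgesInside-play {H = H} x y inside f f∈ v∈f =
  let f∈H , y∉f = E-play⁻ H x y f∈ in
  x∈p∧x≢y⇒x∈p-y (inside f f∈H v∈f) λ { refl → y∉f v∈f }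

¬TrivialWin⇒2≤∣U∣ : ∀ {H : MH n} {f} → EdgesInside H → f ∈ₗ E H → ¬ TrivialWin H → 2 ≤ ∣ U H ∣
¬TrivialWin⇒2≤∣U∣ {H = H} {f} inside f∈ not-won =
  ≤-trans (≰⇒> λ ≤1 → not-won (f , f∈ , ≤1)) (p⊆q⇒∣p∣≤∣q∣ λ v∈ →
    let v∈f , v∉M = x∈p─q⁻ f (M H) v∈ in U⁺ H (inside f f∈ v∈f) v∉M)

spanned : MH n → ℕ → (ℕ → Subset n) → MH n
spanned {n} H k ε = mkMH (⋃ edges) edges (⋃ edges ∩ M H)
  where
  edges : List (Subset n)
  edges = applyUpTo (ε ∘ suc) k

module _ (H : MH n) (k : ℕ) (ε : ℕ → Subset n) where

  open Equivalence

  E-spanned : ∀ f → f ∈ₗ E (spanned H k ε) ⇔ (∃[ i ] (1 ≤ i × i ≤ k × f ≡ ε i))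
  E-spanned f = mk⇔
    (λ f∈ → let i , i<k , f≡ = ∈-applyUpTo⁻ (ε ∘ suc) f∈ in suc i , s≤s z≤n , i<k , f≡)
    (λ { (suc i , _ , i<k , refl) → ∈-applyUpTo⁺ (ε ∘ suc) i<k })

  V-spanned : ∀ v → v ∈ V (spanned H k ε) ⇔ (∃[ i ] (1 ≤ i × i ≤ k × v ∈ ε i))
  V-spanned v = mk⇔
    (λ v∈ → let f , f∈ , v∈f = x∈⋃⁻ _ v∈ ; i , 1≤i , i≤k , f≡ = to (E-spanned f) f∈
            in i , 1≤i , i≤k , subst (v ∈_) f≡ v∈f)
    (λ (i , 1≤i , i≤k , v∈) → x∈⋃⁺ _ (from (E-spanned (ε i)) (i , 1≤i , i≤k , refl)) v∈)

  spanned-sub : 1 ≤ k → EdgesInside H → (∀ i → 1 ≤ i → i ≤ k → ε i ∈ₗ E H × Nonempty (ε i)) →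
                IsSub (spanned H k ε) H
  spanned-sub 1≤k inside edge =
    ( (let v , v∈ = proj₂ (edge 1 ≤-refl 1≤k) in v , from (V-spanned v) (1 , ≤-refl , 1≤k , v∈))
    , (λ f f∈ → let i , 1≤i , i≤k , f≡ = to (E-spanned f) f∈ in
                subst Nonempty (sym f≡) (proj₂ (edge i 1≤i i≤k)))
    , (λ f f∈ {v} v∈f → let i , 1≤i , i≤k , f≡ = to (E-spanned f) f∈ in
                        from (V-spanned v) (i , 1≤i , i≤k , subst (v ∈_) f≡ v∈f))
    , (λ v∈ → proj₁ (x∈p∩q⁻ _ _ v∈)))
    , (λ {v} v∈ → let i , 1≤i , i≤k , v∈ε = to (V-spanned v) v∈ in
                  inside (ε i) (proj₁ (edge i 1≤i i≤k)) v∈ε)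
    , (λ f f∈ → let i , 1≤i , i≤k , f≡ = to (E-spanned f) f∈ in
                subst (_∈ₗ E H) (sym f≡) (proj₁ (edge i 1≤i i≤k)))
    , refl

infix 4 _≤∞_ _≥∞_

_≤∞_ : ℕ∞ → ℕ → Set
nothing ≤∞ k = ⊥
just m  ≤∞ k = m ≤ k

_≥∞_ : ℕ∞ → ℕ → Set
nothing ≥∞ k = ⊤
just m  ≥∞ k = k ≤ m

module _ {k : ℕ} where

  min∞-≥ : ∀ {a b} → a ≥∞ k → b ≥∞ k → min∞ a b ≥∞ k
  min∞-≥ {nothing}         _   b≥ = b≥
  min∞-≥ {just _} {nothing} a≥ _  = a≥
  min∞-≥ {just _} {just _}  a≥ b≥ = ⊓-glb a≥ b≥

  min∞-≤ˡ : ∀ {a b} → a ≤∞ k → min∞ a b ≤∞ k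
  min∞-≤ˡ {just _} {nothing} a≤ = a≤
  min∞-≤ˡ {just a} {just b}  a≤ = ≤-trans (m⊓n≤m a b) a≤

  min∞-≤ʳ : ∀ {a b} → b ≤∞ k → min∞ a b ≤∞ k
  min∞-≤ʳ {nothing}        b≤ = b≤
  min∞-≤ʳ {just a} {just b} b≤ = ≤-trans (m⊓n≤n a b) b≤

  min∞-≤⁻ : ∀ {a b} → min∞ a b ≤∞ k → a ≤∞ k ⊎ b ≤∞ k
  min∞-≤⁻ {nothing}         b≤ = inj₂ b≤
  min∞-≤⁻ {just _} {nothing} a≤ = inj₁ a≤
  min∞-≤⁻ {just a} {just b}  ≤k with ⊓-sel a b
  ... | inj₁ a⊓b≡a = inj₁ (subst (_≤ k) a⊓b≡a ≤k)
  ... | inj₂ a⊓b≡b = inj₂ (subst (_≤ k) a⊓b≡b ≤k)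

  max∞-≥ˡ : ∀ {a b} → a ≥∞ k → max∞ a b ≥∞ k
  max∞-≥ˡ {nothing}         _  = tt
  max∞-≥ˡ {just _} {nothing} _  = tt
  max∞-≥ˡ {just a} {just b}  a≥ = ≤-trans a≥ (m≤m⊔n a b)

  max∞-≥ʳ : ∀ {a b} → b ≥∞ k → max∞ a b ≥∞ k
  max∞-≥ʳ {nothing}         _  = tt
  max∞-≥ʳ {just _} {nothing} _  = tt
  max∞-≥ʳ {just a} {just b}  b≥ = ≤-trans b≥ (m≤n⊔m a b)

  max∞-≤ : ∀ {a b} → a ≤∞ k → b ≤∞ k → max∞ a b ≤∞ k
  max∞-≤ {just _} {just _} = ⊔-lub

  max∞-≤⁻ : ∀ {a b} → max∞ a b ≤∞ k → a ≤∞ k × b ≤∞ k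
  max∞-≤⁻ {just a} {just b} ≤k = ≤-trans (m≤m⊔n a b) ≤k , ≤-trans (m≤n⊔m a b) ≤k

  suc∞-≤ : ∀ {a} → a ≤∞ k → suc∞ a ≤∞ suc k
  suc∞-≤ {just _} = s≤s

  suc∞-≤⁻ : ∀ {a} → suc∞ a ≤∞ k → a ≤∞ k
  suc∞-≤⁻ {just a} ≤k = ≤-trans (n≤1+n a) ≤k

  suc∞-≥ : ∀ {a} → a ≥∞ k → suc∞ a ≥∞ suc k
  suc∞-≥ {nothing} _ = tt
  suc∞-≥ {just _}  = s≤s

  ≤∞-weaken : ∀ {a j} → a ≤∞ j → j ≤ k → a ≤∞ k
  ≤∞-weaken {just _} = ≤-trans

suc∞-≥1 : ∀ a → suc∞ a ≥∞ 1
suc∞-≥1 nothing  = tt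
suc∞-≥1 (just _) = s≤s z≤n

≤∞-≥∞⇒≡ : ∀ {a k} → a ≤∞ k → a ≥∞ k → a ≡ just k
≤∞-≥∞⇒≡ {just _} a≤ a≥ = cong just (≤-antisym a≤ a≥)

module _ {A : Set} {k : ℕ} (f : A → ℕ∞) where

  minOver-≥ : ∀ xs → (∀ x → x ∈ₗ xs → f x ≥∞ k) → minOver xs f ≥∞ k
  minOver-≥ []       _   = tt
  minOver-≥ (x ∷ xs) all = min∞-≥ {a = f x} (all x (Any.here refl)) (minOver-≥ xs (λ y → all y ∘ Any.there))

  minOver-≤ : ∀ {x xs} → x ∈ₗ xs → f x ≤∞ k → minOver xs f ≤∞ k
  minOver-≤ {xs = y ∷ _} (Any.here refl) ≤k = min∞-≤ˡ {a = f y} ≤k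
  minOver-≤ {xs = y ∷ _} (Any.there x∈)  ≤k = min∞-≤ʳ {a = f y} (minOver-≤ x∈ ≤k)

  minOver-≤⁻ : ∀ xs → minOver xs f ≤∞ k → ∃[ x ] (x ∈ₗ xs × f x ≤∞ k)
  minOver-≤⁻ (y ∷ xs) ≤k with min∞-≤⁻ {a = f y} ≤k
  ... | inj₁ fy≤ = y , Any.here refl , fy≤
  ... | inj₂ rest≤ = let x , x∈ , fx≤ = minOver-≤⁻ xs rest≤ in x , Any.there x∈ , fx≤

  maxOver-≥ : ∀ {x xs} → x ∈ₗ xs → f x ≥∞ k → maxOver xs f ≥∞ k
  maxOver-≥ {xs = y ∷ _} (Any.here refl) ≥k = max∞-≥ˡ {a = f y} ≥k
  maxOver-≥ {xs = y ∷ _} (Any.there x∈)  ≥k = max∞-≥ʳ {a = f y} (maxOver-≥ x∈ ≥k)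

  maxOver-≤ : ∀ xs → (∀ x → x ∈ₗ xs → f x ≤∞ k) → maxOver xs f ≤∞ k
  maxOver-≤ []       _   = z≤n
  maxOver-≤ (x ∷ xs) all = max∞-≤ {a = f x} (all x (Any.here refl)) (maxOver-≤ xs (λ y → all y ∘ Any.there))

  maxOver-≤⁻ : ∀ xs → maxOver xs f ≤∞ k → ∀ x → x ∈ₗ xs → f x ≤∞ k
  maxOver-≤⁻ (y ∷ xs) ≤k .y (Any.here refl) = proj₁ (max∞-≤⁻ {a = f y} ≤k)
  maxOver-≤⁻ (y ∷ xs) ≤k x  (Any.there x∈)  = maxOver-≤⁻ xs (proj₂ (max∞-≤⁻ {a = f y} ≤k)) x x∈

∈-elems⁺ : ∀ {x : Fin n} {p} → x ∈ p → x ∈ₗ elems p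
∈-elems⁺ {x = x} {p} = ∈-filter⁺ (_∈? p) (∈-allFin x)

∈-elems⁻ : ∀ {x : Fin n} {p} → x ∈ₗ elems p → x ∈ p
∈-elems⁻ {n = n} {p = p} = proj₂ ∘ ∈-filter⁻ (_∈? p) {xs = Data.List.allFin n}

TwoFree : MH n → Set
TwoFree H = ∀ f → f ∈ₗ E H → 2 ≤ ∣ f ─ M H ∣

trivialB-reflects : ∀ (H : MH n) → Reflects (TrivialWin H) (trivialB H)
trivialB-reflects H = fromEquivalence
  (λ t → let f , f∈ , ≤1 = find (any⁻ _ (E H) t) in f , f∈ , ≤ᵇ⇒≤ _ 1 ≤1)
  (λ (f , f∈ , ≤1) → any⁺ _ (lose f∈ (≤⇒≤ᵇ ≤1)))

trivialWin? : ∀ (H : MH n) → Dec (TrivialWin H)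
trivialWin? H = trivialB H because trivialB-reflects H

TwoFree⇒¬TrivialWin : ∀ {H : MH n} → TwoFree H → ¬ TrivialWin H
TwoFree⇒¬TrivialWin free (f , f∈ , ≤1) = <⇒≱ (free f f∈) ≤1

tauF-≤1 : ∀ fuel (H : MH n) → TrivialWin H → tauF fuel H ≤∞ 1
tauF-≤1 fuel H (f , f∈ , ≤1) with trivialB H | trivialB-reflects H
... | true  | _       = minOver-≤ _ f∈ ≤1
... | false | ofⁿ ¬tw = ⊥-elim (¬tw (f , f∈ , ≤1))

tauF-play-≤ : ∀ fuel k (H : MH n) x → x ∈ U H → 2 ≤ ∣ U H ∣ →
              (∀ y → y ∈ U H → y ≢ x → tauF fuel (play x y H) ≤∞ k) →
              tauF (suc fuel) H ≤∞ suc k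
tauF-play-≤ fuel k H x x∈U 2≤∣U∣ answer with trivialB H | trivialB-reflects H
... | true  | ofʸ (f , f∈ , ≤1) = minOver-≤ _ f∈ (≤-trans ≤1 (s≤s z≤n))
... | false | _ with ∣ U H ∣ ≤ᵇ 1 | ≤ᵇ-reflects-≤ ∣ U H ∣ 1
...   | true  | ofʸ ∣U∣≤1 = ⊥-elim (<⇒≱ 2≤∣U∣ ∣U∣≤1)
...   | false | _ = suc∞-≤ (minOver-≤ _ (∈-elems⁺ x∈U) (maxOver-≤ _ _ λ y y∈ →
                      let y∈U , y≢x = x∈p-y⁻ (U H) (∈-elems⁻ y∈) in answer y y∈U y≢x))

tauF-play-≥ : ∀ fuel k (H : MH n) → TwoFree H →
              (∀ x → x ∈ U H → 2 ≤ ∣ U H ∣ →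
                 ∃[ y ] (y ∈ U H × y ≢ x × tauF fuel (play x y H) ≥∞ k)) →
              tauF (suc fuel) H ≥∞ suc k
tauF-play-≥ fuel k H free answer with trivialB H | trivialB-reflects H
... | true  | ofʸ tw = ⊥-elim (TwoFree⇒¬TrivialWin {H = H} free tw)
... | false | _ with ∣ U H ∣ ≤ᵇ 1 | ≤ᵇ-reflects-≤ ∣ U H ∣ 1
...   | true  | _ = tt
...   | false | ofⁿ ∣U∣≰1 = suc∞-≥ (minOver-≥ _ _ λ x x∈ →
          let y , y∈U , y≢x , τ≥ = answer x (∈-elems⁻ x∈) (≰⇒> ∣U∣≰1)
          in maxOver-≥ _ (∈-elems⁺ (x∈p∧x≢y⇒x∈p-y y∈U y≢x)) τ≥)

tauF-zero-≥ : ∀ k (H : MH n) → TwoFree H → tauF 0 H ≥∞ k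
tauF-zero-≥ k H free with trivialB H | trivialB-reflects H
... | true  | ofʸ tw = ⊥-elim (TwoFree⇒¬TrivialWin {H = H} free tw)
... | false | _ with ∣ U H ∣ ≤ᵇ 1
...   | true  = tt
...   | false = tt

tauF-≥1 : ∀ fuel (H : MH n) → (∀ f → f ∈ₗ E H → 1 ≤ ∣ f ─ M H ∣) → tauF fuel H ≥∞ 1
tauF-≥1 fuel H free with trivialB H
... | true = minOver-≥ _ _ free
... | false with ∣ U H ∣ ≤ᵇ 1
...   | true = tt
...   | false with fuel
...     | zero   = tt
...     | suc _  = suc∞-≥1 _

play-keeps-free-vertex : ∀ {H : MH n} → TwoFree H → ∀ x y f →
                         f ∈ₗ E (play x y H) → 1 ≤ ∣ f ─ M (play x y H) ∣
play-keeps-free-vertex {H = H} free x y f f∈ with E-play⁻ H x y f∈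
... | f∈H , _ with 2≤∣p∣⇒another (free f f∈H) x
... | c , c∈ , c≢x = let c∈f , c∉M = x∈p─q⁻ f (M H) c∈ in
  1≤∣f─M∣ c∈f (λ c∈M′ → c∉M (M-play⁻ H x y c∈M′ c≢x))

TrivialWin-play : ∀ {H : MH n} {f} x y → f ∈ₗ E H → ∣ f ─ M H ∣ ≤ 1 → y ∉ f →
                  TrivialWin (play x y H)
TrivialWin-play {H = H} {f} x y f∈ ≤1 y∉f =
  f , E-play⁺ H x y f∈ y∉f , ≤-trans (p⊆q⇒∣p∣≤∣q∣ shrink) ≤1
  where
  shrink : f ─ M (play x y H) ⊆ f ─ M H
  shrink v∈ = let v∈f , v∉M′ = x∈p─q⁻ f _ v∈ in
    x∈p∧x∉q⇒x∈p─q v∈f (λ v∈M → v∉M′ (M-play⁺ H x y v∈M λ { refl → y∉f v∈f }))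

TrivialWin⇒threat : ∀ {H : MH n} → TrivialWin H → 1 ≤ ∣ U H ∣ →
                    ∃[ x ] (x ∈ U H × ∀ y → y ∈ U H → y ≢ x → TrivialWin (play x y H))
TrivialWin⇒threat {H = H} (f , f∈ , ≤1) 1≤∣U∣ with nonempty? ((f ─ M H) ∩ U H)
... | yes (z , z∈) =
  let z∈f─M , z∈U = x∈p∩q⁻ _ _ z∈ in
  z , z∈U , λ y y∈U y≢z → TrivialWin-play {H = H} z y f∈ ≤1 λ y∈f →
    y≢z (∣p∣≤1⇒≡ ≤1 (x∈p∧x∉q⇒x∈p─q y∈f (proj₂ (U⁻ H y∈U))) z∈f─M)
... | no none =
  let x , x∈U = 1≤∣p∣⇒nonempty 1≤∣U∣ in
  x , x∈U , λ y y∈U _ → TrivialWin-play {H = H} x y f∈ ≤1 λ y∈f →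
    none (y , x∈p∩q⁺ (x∈p∧x∉q⇒x∈p─q y∈f (proj₂ (U⁻ H y∈U)) , y∈U))

TrivialWin⇒MakerWin : ∀ b (H : MH n) → ∣ U H ∣ ≤ b → TrivialWin H → MakerWin H
TrivialWin⇒MakerWin b H ∣U∣≤b tw with ∣ U H ∣ ≤? 1
... | yes ∣U∣≤1 = base ∣U∣≤1 tw
TrivialWin⇒MakerWin zero    H ∣U∣≤0 tw | no ∣U∣≰1 = ⊥-elim (∣U∣≰1 (≤-trans ∣U∣≤0 z≤n))
TrivialWin⇒MakerWin (suc b) H ∣U∣≤b tw | no ∣U∣≰1 =
  let x , x∈U , threat = TrivialWin⇒threat tw (≤-trans (s≤s z≤n) (≰⇒> ∣U∣≰1)) in
  step (≰⇒> ∣U∣≰1) x x∈U λ y y∈U y≢x →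
    TrivialWin⇒MakerWin b _ (≤-pred (≤-trans (∣U-play∣<∣U∣ H x _ x∈U) ∣U∣≤b)) (threat y y∈U y≢x)

tauF-finite⇒MakerWin : ∀ fuel k (H : MH n) → tauF fuel H ≤∞ k → MakerWin H
tauF-finite⇒MakerWin fuel k H τ≤k with trivialB H | trivialB-reflects H
... | true | ofʸ tw = TrivialWin⇒MakerWin _ H ≤-refl tw
... | false | _ with ∣ U H ∣ ≤ᵇ 1 | ≤ᵇ-reflects-≤ ∣ U H ∣ 1
tauF-finite⇒MakerWin (suc fuel) k H τ≤k | false | _ | false | ofⁿ ∣U∣≰1 =
  let x , x∈ , max≤k = minOver-≤⁻ _ _ (suc∞-≤⁻ τ≤k) in
  step (≰⇒> ∣U∣≰1) x (∈-elems⁻ x∈) λ y y∈U y≢x →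
    tauF-finite⇒MakerWin fuel k _ (maxOver-≤⁻ _ _ max≤k y (∈-elems⁺ (x∈p∧x≢y⇒x∈p-y y∈U y≢x)))

module _ {P : ℕ → Set} (P? : Decidable P) where

  private
    below-suc : ∀ {b q} → ¬ P b → q < suc b → P q → q < b
    below-suc ¬Pb (s≤s q≤b) Pq = ≤∧≢⇒< q≤b λ { refl → ¬Pb Pq }

    greatest-below : ∀ b → (∃[ q ] (P q × ∀ q′ → q′ < b → P q′ → q′ ≤ q)) ⊎ (∀ q → q < b → ¬ P q)
    greatest-below zero = inj₂ λ _ ()
    greatest-below (suc b) with P? b | greatest-below b
    ... | yes Pb | _ = inj₁ (b , Pb , λ _ q′<1+b _ → ≤-pred q′<1+b)
    ... | no ¬Pb | inj₁ (q , Pq , max) =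
      inj₁ (q , Pq , λ q′ q′< Pq′ → max q′ (below-suc ¬Pb q′< Pq′) Pq′)
    ... | no ¬Pb | inj₂ none = inj₂ λ q q< Pq → none q (below-suc ¬Pb q< Pq) Pq

    least-below : ∀ b → (∃[ q ] (P q × ∀ q′ → P q′ → q ≤ q′)) ⊎ (∀ q → q < b → ¬ P q)
    least-below zero = inj₂ λ _ ()
    least-below (suc b) with least-below b
    ... | inj₁ found = inj₁ found
    ... | inj₂ none with P? b
    ...   | yes Pb = inj₁ (b , Pb , λ q′ Pq′ → ≮⇒≥ λ q′<b → none q′ q′<b Pq′)
    ...   | no ¬Pb = inj₂ λ q q< Pq → none q (below-suc ¬Pb q< Pq) Pq

  greatest : ∀ b → (∀ q → P q → q < b) →
             (∃[ q ] (P q × ∀ q′ → P q′ → q′ ≤ q)) ⊎ (∀ q → ¬ P q)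
  greatest b bounded with greatest-below b
  ... | inj₁ (q , Pq , max) = inj₁ (q , Pq , λ q′ Pq′ → max q′ (bounded q′ Pq′) Pq′)
  ... | inj₂ none = inj₂ λ q Pq → none q (bounded q Pq) Pq

  least : ∀ b → (∀ q → P q → q < b) →
          (∃[ q ] (P q × ∀ q′ → P q′ → q ≤ q′)) ⊎ (∀ q → ¬ P q)
  least b bounded with least-below b
  ... | inj₁ found = inj₁ found
  ... | inj₂ none = inj₂ λ q Pq → none q (bounded q Pq) Pq

⌈k/2⌉≤d : ∀ {k d} → k ≤ d + d → ⌈ k /2⌉ ≤ d
⌈k/2⌉≤d {d = d} k≤2d = ≤-trans (⌈n/2⌉-mono k≤2d) (≤-reflexive (sym (n≡⌈n+n/2⌉ d)))

half-gap-left : ∀ {s t u k} → s ≤ t → s + k ≤ u → u + s ≤ t + t → s + ⌈ k /2⌉ ≤ t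
half-gap-left {s} {t} {u} {k} s≤t s+k≤u u+s≤2t with m≤n⇒∃[o]m+o≡n s≤t
... | d , refl = +-monoʳ-≤ s (⌈k/2⌉≤d (+-cancelˡ-≤ (s + s) k (d + d) (begin
  s + s + k        ≡⟨ xy∙z≈xz∙y s s k ⟩
  s + k + s        ≤⟨ +-monoˡ-≤ s s+k≤u ⟩
  u + s            ≤⟨ u+s≤2t ⟩
  s + d + (s + d)  ≡⟨ interchange s d s d ⟩
  s + s + (d + d)  ∎)))
  where
  open ≤-Reasoning

half-gap-right : ∀ {s t u k} → t ≤ u → s + k ≤ u → t + t ≤ s + u → t + ⌈ k /2⌉ ≤ u
half-gap-right {s} {t} {u} {k} t≤u s+k≤u 2t≤s+u with m≤n⇒∃[o]m+o≡n t≤u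
... | d , refl = +-monoʳ-≤ t (⌈k/2⌉≤d (+-cancelˡ-≤ s k (d + d) (begin
  s + k        ≤⟨ s+k≤u ⟩
  t + d        ≤⟨ +-monoˡ-≤ d t≤s+d ⟩
  s + d + d    ≡⟨ +-assoc s d d ⟩
  s + (d + d)  ∎)))
  where
  open ≤-Reasoning
  t≤s+d : t ≤ s + d
  t≤s+d = +-cancelˡ-≤ t t (s + d)
    (≤-trans 2t≤s+u (≤-reflexive (x∙yz≈y∙xz s t d)))

⌈log₂n⌉≡1+⌈log₂⌈n/2⌉⌉ : ∀ m → 2 ≤ m → ⌈log₂ m ⌉ ≡ suc ⌈log₂ ⌈ m /2⌉ ⌉
⌈log₂n⌉≡1+⌈log₂⌈n/2⌉⌉ m 2≤m =
  sym (trans (cong suc (⌈log₂⌈n/2⌉⌉≡⌈log₂n⌉∸1 m)) (m+[n∸m]≡n (⌈log₂⌉-mono-≤ 2≤m)))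

-- Necklaces: joints and pendants

module Necklace {n : ℕ} (C : MH n) (e : ℕ → Subset n) (L : ℕ) (a : Fin n)
  (2≤L      : 2 ≤ L)
  (∣e∣≡3    : ∀ i → 1 ≤ i → i ≤ L → ∣ e i ∣ ≡ 3)
  (V-iff    : ∀ v → (v ∈ V C) ⇔ (∃[ i ] (1 ≤ i × i ≤ L × v ∈ e i)))
  (E-iff    : ∀ f → (f ∈ₗ E C) ⇔ (∃[ i ] (1 ≤ i × i ≤ L × f ≡ e i)))
  (a∈e₁     : a ∈ e 1)
  (a∈eL     : a ∈ e L)
  (a∉e      : ∀ i → 1 < i → i < L → a ∉ e i)
  (twoEdges : L ≡ 2 → ∣ e 1 ∩ e 2 ∣ ≡ 2)
  (longCycle : 3 ≤ L →
       (∀ i → 1 ≤ i → i < L → ∣ e i ∩ e (suc i) ∣ ≡ 1)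
     × (e 1 ∩ e L ≡ ⁅ a ⁆)
     × (∀ i j → 1 ≤ i → i + 2 ≤ j → j ≤ L → ¬ (i ≡ 1 × j ≡ L) → e i ∩ e j ≡ ∅))
  (M-iff    : ∀ v → v ∈ V C → (v ∈ M C ⇔ v ≡ a))
  where

  open Equivalence
  open import Data.List.Membership.DecPropositional {A = Subset n} (≡-dec _≟ᵇ_)
    using () renaming (_∈?_ to _∈ₗ?_)

  L≡2⊎3≤L : L ≡ 2 ⊎ 3 ≤ L
  L≡2⊎3≤L with m≤n⇒m<n∨m≡n 2≤L
  ... | inj₁ 3≤L = inj₂ 3≤L
  ... | inj₂ 2≡L = inj₁ (sym 2≡L)

  1≤L : 1 ≤ L
  1≤L = ≤-trans (s≤s z≤n) 2≤L

  e∈E : ∀ {i} → 1 ≤ i → i ≤ L → e i ∈ₗ E C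
  e∈E 1≤i i≤L = from (E-iff _) (_ , 1≤i , i≤L , refl)

  e⊆V : ∀ {i v} → 1 ≤ i → i ≤ L → v ∈ e i → v ∈ V C
  e⊆V 1≤i i≤L v∈ = from (V-iff _) (_ , 1≤i , i≤L , v∈)

  E⊆V : ∀ f → f ∈ₗ E C → f ⊆ V C
  E⊆V f f∈ v∈ with to (E-iff f) f∈
  ... | i , 1≤i , i≤L , refl = e⊆V 1≤i i≤L v∈

  a∈V : a ∈ V C
  a∈V = e⊆V ≤-refl 1≤L a∈e₁

  a∈M : a ∈ M C
  a∈M = from (M-iff a a∈V) refl

  marked⇒a : ∀ {v} → v ∈ V C → v ∈ M C → v ≡ a
  marked⇒a v∈V = to (M-iff _ v∈V)

  inner-meet : ∀ t → 1 ≤ t → t < L → Nonempty (e t ∩ e (suc t) - a)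
  inner-meet t 1≤t t<L with L≡2⊎3≤L
  ... | inj₁ refl with ≤-antisym (≤-pred t<L) 1≤t
  ...   | refl = let z , z∈ , z≢a = 2≤∣p∣⇒another (≤-reflexive (sym (twoEdges refl))) a
                 in z , x∈p∧x≢y⇒x∈p-y z∈ z≢a
  inner-meet t 1≤t t<L | inj₂ 3≤L =
    let z , z∈ = 1≤∣p∣⇒nonempty (≤-reflexive (sym (proj₁ (longCycle 3≤L) t 1≤t t<L)))
        z∈et , z∈et+1 = x∈p∩q⁻ (e t) (e (suc t)) z∈
    in z , x∈p∧x≢y⇒x∈p-y z∈ (≢a z∈et z∈et+1)
    where
    ≢a : ∀ {z} → z ∈ e t → z ∈ e (suc t) → z ≢ a
    ≢a z∈et z∈et+1 z≡a with t ≟ 1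
    ... | yes refl = a∉e 2 ≤-refl 3≤L (subst (_∈ e 2) z≡a z∈et+1)
    ... | no  t≢1  = a∉e t (≤∧≢⇒< 1≤t (t≢1 ∘ sym)) t<L (subst (_∈ e t) z≡a z∈et)

  -- joint t is the vertex shared by e t and e (t + 1), with joint 0 = joint L = a;
  -- pendant s is the third vertex of e s.
  abstract
    joint : ℕ → Fin n
    joint zero = a
    joint (suc t) with suc t <? L
    ... | yes _ = pick a (e (suc t) ∩ e (suc (suc t)) - a)
    ... | no  _ = a

    joint-0 : joint 0 ≡ a
    joint-0 = refl

    joint-L : joint L ≡ a
    joint-L = joint-≥L L ≤-refl
      where
      joint-≥L : ∀ t → L ≤ t → joint t ≡ a
      joint-≥L zero    _   = refl
      joint-≥L (suc t) L≤t with suc t <? L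
      ... | yes t<L = ⊥-elim (<⇒≱ t<L L≤t)
      ... | no  _   = refl

    joint-inner : ∀ t → 1 ≤ t → t < L → joint t ∈ e t × joint t ∈ e (suc t) × joint t ≢ a
    joint-inner (suc t) 1≤t t<L with suc t <? L
    ... | no  t≮L = ⊥-elim (t≮L t<L)
    ... | yes _   =
      let j∈ , j≢a = x∈p-y⁻ _ (pick∈ a (inner-meet (suc t) 1≤t t<L))
          j∈et , j∈et+1 = x∈p∩q⁻ (e (suc t)) _ j∈
      in j∈et , j∈et+1 , j≢a

    pendant : ℕ → Fin n
    pendant s = pick a (e s - joint (pred s) - joint s)

    pendant-spec : ∀ s → 1 ≤ s → s ≤ L →
                   pendant s ∈ e s × pendant s ≢ joint (pred s) × pendant s ≢ joint s
    pendant-spec s 1≤s s≤L =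
      let z , z∈ , z≢j , z≢j′ = 3≤∣p∣⇒third (≤-reflexive (sym (∣e∣≡3 s 1≤s s≤L))) (joint (pred s)) (joint s)
          p∈ , p≢j′ = x∈p-y⁻ _ (pick∈ a (z , x∈p∧x≢y⇒x∈p-y (x∈p∧x≢y⇒x∈p-y z∈ z≢j) z≢j′))
          p∈e , p≢j = x∈p-y⁻ _ p∈
      in p∈e , p≢j , p≢j′

  joint∈e : ∀ t → 1 ≤ t → t ≤ L → joint t ∈ e t
  joint∈e t 1≤t t≤L with m≤n⇒m<n∨m≡n t≤L
  ... | inj₁ t<L  = proj₁ (joint-inner t 1≤t t<L)
  ... | inj₂ refl = subst (_∈ e L) (sym joint-L) a∈eL

  joint∈e-suc : ∀ t → t < L → joint t ∈ e (suc t)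
  joint∈e-suc zero    _   = subst (_∈ e 1) (sym joint-0) a∈e₁
  joint∈e-suc (suc t) t<L = proj₁ (proj₂ (joint-inner (suc t) (s≤s z≤n) t<L))

  joint-pred∈e : ∀ s → 1 ≤ s → s ≤ L → joint (pred s) ∈ e s
  joint-pred∈e (suc s) _ s<L = joint∈e-suc s s<L

  joint∈V : ∀ t → t ≤ L → joint t ∈ V C
  joint∈V zero    _   = subst (_∈ V C) (sym joint-0) a∈V
  joint∈V (suc t) t<L = e⊆V (s≤s z≤n) t<L (joint∈e (suc t) (s≤s z≤n) t<L)

  joint≢a : ∀ t → 1 ≤ t → t < L → joint t ≢ a
  joint≢a t 1≤t t<L = proj₂ (proj₂ (joint-inner t 1≤t t<L))

  far-edges-disjoint : ∀ {p q v} → 3 ≤ L → 1 ≤ p → p < q → q ≢ suc p → q ≤ L →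
                       ¬ (p ≡ 1 × q ≡ L) → v ∈ e p → v ∈ e q → ⊥
  far-edges-disjoint {p} {q} {v} 3≤L 1≤p p<q q≢1+p q≤L not-closing v∈p v∈q =
    ∉⊥ (subst (v ∈_) (proj₂ (proj₂ (longCycle 3≤L)) p q 1≤p p+2≤q q≤L not-closing) (x∈p∩q⁺ (v∈p , v∈q)))
    where
    p+2≤q : p + 2 ≤ q
    p+2≤q = subst (_≤ q) (+-comm 2 p) (≤∧≢⇒< p<q (q≢1+p ∘ sym))

  shared-vertex : ∀ {p q v} → 1 ≤ p → p < q → q ≤ L → v ∈ e p → v ∈ e q →
                  (q ≡ suc p × v ≡ joint p) ⊎ (p ≡ 1 × q ≡ L × v ≡ a)
  shared-vertex {p} {q} {v} 1≤p p<q q≤L v∈p v∈q with L≡2⊎3≤L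
  ... | inj₁ refl with ≤-antisym (≤-pred (≤-trans p<q q≤L)) 1≤p | ≤-antisym q≤L (≤-trans (s≤s 1≤p) p<q)
  ...   | refl | refl with ∣p∣≤2⇒≡ (≤-reflexive (twoEdges refl)) (x∈p∩q⁺ (a∈e₁ , a∈eL))
                                 (x∈p∩q⁺ (joint∈e 1 ≤-refl 1≤L , joint∈e-suc 1 ≤-refl))
                                 (x∈p∩q⁺ (v∈p , v∈q)) (joint≢a 1 ≤-refl ≤-refl ∘ sym)
  ...     | inj₁ v≡a = inj₂ (refl , refl , v≡a)
  ...     | inj₂ v≡j = inj₁ (refl , v≡j)
  shared-vertex {p} {q} {v} 1≤p p<q q≤L v∈p v∈q | inj₂ 3≤L with q ≟ suc p
  ... | yes refl =
    inj₁ (refl , ∣p∣≤1⇒≡ (≤-reflexive (proj₁ (longCycle 3≤L) p 1≤p q≤L)) (x∈p∩q⁺ (v∈p , v∈q))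
                        (x∈p∩q⁺ (joint∈e p 1≤p (<⇒≤ q≤L) , joint∈e-suc p q≤L)))
  ... | no q≢1+p with p ≟ 1 | q ≟ L
  ...   | yes refl | yes refl =
    inj₂ (refl , refl , x∈⁅y⁆⇒x≡y a (subst (v ∈_) (proj₁ (proj₂ (longCycle 3≤L))) (x∈p∩q⁺ (v∈p , v∈q))))
  ...   | yes _    | no q≢L = ⊥-elim (far-edges-disjoint 3≤L 1≤p p<q q≢1+p q≤L (q≢L ∘ proj₂) v∈p v∈q)
  ...   | no p≢1   | _      = ⊥-elim (far-edges-disjoint 3≤L 1≤p p<q q≢1+p q≤L (p≢1 ∘ proj₁) v∈p v∈q)

  joint-injective : ∀ {u t} → u < t → t ≤ L → joint u ≡ joint t → u ≡ 0 × t ≡ L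
  joint-injective {zero} {t} u<t t≤L ju≡jt with m≤n⇒m<n∨m≡n t≤L
  ... | inj₂ t≡L = refl , t≡L
  ... | inj₁ t<L = ⊥-elim (joint≢a t u<t t<L (trans (sym ju≡jt) joint-0))
  joint-injective {suc u} {t} u<t t≤L ju≡jt with m≤n⇒m<n∨m≡n t≤L
  ... | inj₂ refl = ⊥-elim (joint≢a (suc u) (s≤s z≤n) u<t (trans ju≡jt joint-L))
  ... | inj₁ t<L with shared-vertex (s≤s z≤n) (m≤n⇒m≤1+n u<t) t<L
                        (proj₁ (joint-inner (suc u) (s≤s z≤n) (<-≤-trans u<t t≤L)))
                        (subst (_∈ e (suc t)) (sym ju≡jt) (joint∈e-suc t t<L))
  ...   | inj₁ (1+t≡2+u , _) = ⊥-elim (<-irrefl (sym (suc-injective 1+t≡2+u)) u<t)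
  ...   | inj₂ (_ , _ , j≡a)  = ⊥-elim (joint≢a (suc u) (s≤s z≤n) (<-≤-trans u<t t≤L) j≡a)

  joint-pred≢joint : ∀ s → 1 ≤ s → s ≤ L → joint (pred s) ≢ joint s
  joint-pred≢joint (suc s) _ s<L j≡j with joint-injective ≤-refl s<L j≡j
  ... | refl , 1≡L = <⇒≱ 2≤L (≤-reflexive (sym 1≡L))

  pendant-private : ∀ {s q} → 1 ≤ s → s ≤ L → 1 ≤ q → q ≤ L → pendant s ∈ e q → q ≡ s
  pendant-private {s} {q} 1≤s s≤L 1≤q q≤L p∈eq with <-cmp q s | pendant-spec s 1≤s s≤L
  ... | tri≈ _ q≡s _ | _ = q≡s
  ... | tri< q<s _ _ | p∈es , p≢j , p≢j′ with shared-vertex 1≤q q<s s≤L p∈eq p∈es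
  ...   | inj₁ (refl , p≡j)       = ⊥-elim (p≢j p≡j)
  ...   | inj₂ (_ , refl , p≡a)   = ⊥-elim (p≢j′ (trans p≡a (sym joint-L)))
  pendant-private {s} {q} 1≤s s≤L 1≤q q≤L p∈eq | tri> _ _ s<q | p∈es , p≢j , p≢j′
    with shared-vertex 1≤s s<q q≤L p∈es p∈eq
  ...   | inj₁ (refl , p≡j)       = ⊥-elim (p≢j′ p≡j)
  ...   | inj₂ (refl , _ , p≡a)   = ⊥-elim (p≢j (trans p≡a (sym joint-0)))

  joint≢pendant : ∀ {t s} → t ≤ L → 1 ≤ s → s ≤ L → joint t ≢ pendant s
  joint≢pendant {zero} {s} _ 1≤s s≤L j≡p
    with pendant-private 1≤s s≤L ≤-refl 1≤L (subst (_∈ e 1) (trans (sym joint-0) j≡p) a∈e₁)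
  ... | refl = proj₁ (proj₂ (pendant-spec 1 1≤s s≤L)) (sym j≡p)
  joint≢pendant {suc t} {s} t<L 1≤s s≤L j≡p
    with pendant-private 1≤s s≤L (s≤s z≤n) t<L (subst (_∈ e (suc t)) j≡p (joint∈e (suc t) (s≤s z≤n) t<L))
  ... | refl = proj₂ (proj₂ (pendant-spec (suc t) 1≤s s≤L)) (sym j≡p)

  pendant≢a : ∀ {s} → 1 ≤ s → s ≤ L → pendant s ≢ a
  pendant≢a 1≤s s≤L p≡a = joint≢pendant z≤n 1≤s s≤L (trans joint-0 (sym p≡a))

  edge-vertex : ∀ {s v} → 1 ≤ s → s ≤ L → v ∈ e s →
                v ≡ joint (pred s) ⊎ v ≡ joint s ⊎ v ≡ pendant s
  edge-vertex {s} 1≤s s≤L v∈ =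
    let p∈ , p≢j , p≢j′ = pendant-spec s 1≤s s≤L in
    ∣p∣≡3⇒≡ (∣e∣≡3 s 1≤s s≤L) (joint-pred∈e s 1≤s s≤L) (joint∈e s 1≤s s≤L) p∈ v∈
            (joint-pred≢joint s 1≤s s≤L) (p≢j ∘ sym) (p≢j′ ∘ sym)

  vertex-kind : ∀ {v} → v ∈ V C →
                (∃[ t ] (t ≤ L × v ≡ joint t)) ⊎ (∃[ s ] (1 ≤ s × s ≤ L × v ≡ pendant s))
  vertex-kind {v} v∈V with to (V-iff v) v∈V
  ... | s , 1≤s , s≤L , v∈ with edge-vertex 1≤s s≤L v∈
  ...   | inj₁ v≡j        = inj₁ (pred s , ≤-trans pred[n]≤n s≤L , v≡j)
  ...   | inj₂ (inj₁ v≡j) = inj₁ (s , s≤L , v≡j)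
  ...   | inj₂ (inj₂ v≡p) = inj₂ (s , 1≤s , s≤L , v≡p)

  -- Maker's strategy

  EdgesPresent : MH n → ℕ → ℕ → Set
  EdgesPresent H s t = ∀ r → s < r → r ≤ t → e r ∈ₗ E H

  record MarkedArc (H : MH n) (s t : ℕ) : Set where
    constructor arc
    field
      s<t     : s < t
      t≤L     : t ≤ L
      start∈M : joint s ∈ M H
      end∈M   : joint t ∈ M H
      edges   : EdgesPresent H s t

  short-arc-won : ∀ {H s} → MarkedArc H s (suc s) → TrivialWin H
  short-arc-won {s = s} (arc _ t≤L js∈M jt∈M edges) =
    e (suc s) , edges (suc s) ≤-refl ≤-refl ,
    ∣f─M∣≤1 (∣e∣≡3 (suc s) (s≤s z≤n) t≤L) (joint∈e-suc s t≤L) (joint∈e (suc s) (s≤s z≤n) t≤L)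
            (joint-pred≢joint (suc s) (s≤s z≤n) t≤L) js∈M jt∈M

  arc-start≤L : ∀ {H s t} → MarkedArc H s t → s ≤ L
  arc-start≤L (arc s<t t≤L _ _ _) = <⇒≤ (<-≤-trans s<t t≤L)

  arc-prefix : ∀ {H s c t} → MarkedArc H s t → s < c → c ≤ t → joint c ∈ M H → MarkedArc H s c
  arc-prefix (arc _ t≤L js∈M _ edges) s<c c≤t jc∈M =
    arc s<c (≤-trans c≤t t≤L) js∈M jc∈M λ r s<r r≤c → edges r s<r (≤-trans r≤c c≤t)

  arc-survives : ∀ {H s c t y} → MarkedArc H s t → s < c → c < t → y ∉ M H → y ≢ joint c →
                 MarkedArc (play (joint c) y H) s c ⊎ MarkedArc (play (joint c) y H) c t
  arc-survives {H} {s} {c} {t} {y} (arc s<t t≤L js∈M jt∈M edges) s<c c<t y∉M y≢jc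
    with anyUpTo? (λ q → (s <? q) ×-dec (y ∈? e q)) (suc c)
  ... | no untouched =
    inj₁ (arc s<c (<⇒≤ (<-≤-trans c<t t≤L))
              (M-play⁺ H (joint c) y js∈M (u∈p∧v∉p⇒u≢v js∈M y∉M)) (x∈M-play H (joint c) y (y≢jc ∘ sym))
              λ r s<r r≤c → E-play⁺ H (joint c) y (edges r s<r (≤-trans r≤c (<⇒≤ c<t)))
                                     λ y∈er → untouched (r , s≤s r≤c , s<r , y∈er))
  ... | yes (q , s≤s q≤c , s<q , y∈eq) =
    inj₂ (arc c<t t≤L
              (x∈M-play H (joint c) y (y≢jc ∘ sym)) (M-play⁺ H (joint c) y jt∈M (u∈p∧v∉p⇒u≢v jt∈M y∉M))
              λ r c<r r≤t → E-play⁺ H (joint c) y (edges r (<-trans s<c c<r) r≤t) (y∉right r c<r r≤t))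
    where
    y∉right : ∀ r → c < r → r ≤ t → y ∉ e r
    y∉right r c<r r≤t y∈er
      with shared-vertex (≤-trans (s≤s z≤n) s<q) (≤-<-trans q≤c c<r) (≤-trans r≤t t≤L) y∈eq y∈er
    ... | inj₁ (refl , y≡jq) = y≢jc (subst (λ i → y ≡ joint i) (≤-antisym q≤c (≤-pred c<r)) y≡jq)
    ... | inj₂ (refl , _ , y≡a) =
      y∉M (subst (_∈ M H) (trans (cong joint (n<1⇒n≡0 s<q)) (trans joint-0 (sym y≡a))) js∈M)

  arc⇒2≤∣U∣ : ∀ {H s t} → EdgesInside H → ¬ TrivialWin H → MarkedArc H s t → 2 ≤ ∣ U H ∣
  arc⇒2≤∣U∣ {s = s} inside not-won (arc s<t _ _ _ edges) =
    ¬TrivialWin⇒2≤∣U∣ inside (edges (suc s) ≤-refl s<t) not-won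

  split-arc-τ≤ : ∀ fuel {H s c t k} → EdgesInside H → ∣ U H ∣ ≤ fuel → ¬ TrivialWin H →
                 MarkedArc H s t → s < c → c < t → joint c ∉ M H →
                 (∀ {H′} → EdgesInside H′ → ∣ U H′ ∣ ≤ pred fuel →
                    MarkedArc H′ s c ⊎ MarkedArc H′ c t → tauF (pred fuel) H′ ≤∞ k) →
                 tauF fuel H ≤∞ suc k
  split-arc-τ≤ zero inside ∣U∣≤0 not-won a _ _ _ _ =
    ⊥-elim (<⇒≱ (≤-trans (arc⇒2≤∣U∣ inside not-won a) ∣U∣≤0) z≤n)
  split-arc-τ≤ (suc fuel) {H} {s} {c} {t} inside ∣U∣≤fuel not-won a s<c c<t jc∉M halves =
    tauF-play-≤ fuel _ H (joint c) jc∈U (arc⇒2≤∣U∣ inside not-won a) λ y y∈U y≢jc →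
      halves (EdgesInside-play {H = H} (joint c) y inside)
             (≤-pred (≤-trans (∣U-play∣<∣U∣ H (joint c) y jc∈U) ∣U∣≤fuel))
             (arc-survives a s<c c<t (proj₂ (U⁻ H y∈U)) y≢jc)
    where
    jc∈U : joint c ∈ U H
    jc∈U = U⁺ H (inside _ (MarkedArc.edges a c s<c (<⇒≤ c<t))
                        (joint∈e c (≤-trans (s≤s z≤n) s<c) (≤-trans (<⇒≤ c<t) (MarkedArc.t≤L a))))
                jc∉M

  ArcBound : ℕ → Set
  ArcBound m = ∀ {s fuel H} → EdgesInside H → ∣ U H ∣ ≤ fuel → MarkedArc H s (s + m) →
               tauF fuel H ≤∞ suc ⌈log₂ m ⌉

  arc-halving : ∀ m′ → (∀ {k} → k < 2 + m′ → ArcBound k) → ArcBound (2 + m′)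
  arc-halving m′ rec {s} {fuel} {H} inside ∣U∣≤fuel a = bound
    where
    m h r : ℕ
    m = 2 + m′
    h = ⌊ m /2⌋
    r = ⌈ m /2⌉
    s<s+h : s < s + h
    s<s+h = subst (_≤ s + h) (+-comm s 1) (+-monoʳ-≤ s (s≤s z≤n))
    s+h<s+m : s + h < s + m
    s+h<s+m = +-monoʳ-< s (⌊n/2⌋<n (suc m′))
    s+m≡s+h+r : s + m ≡ s + h + r
    s+m≡s+h+r = trans (cong (s +_) (sym (⌊n/2⌋+⌈n/2⌉≡n m))) (sym (+-assoc s h r))
    left : ∀ {fuel′ H′} → EdgesInside H′ → ∣ U H′ ∣ ≤ fuel′ → MarkedArc H′ s (s + h) →
           tauF fuel′ H′ ≤∞ suc ⌈log₂ r ⌉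
    left inside′ ∣U′∣ a′ =
      ≤∞-weaken (rec (⌊n/2⌋<n (suc m′)) inside′ ∣U′∣ a′) (s≤s (⌈log₂⌉-mono-≤ (⌊n/2⌋≤⌈n/2⌉ m)))
    right : ∀ {fuel′ H′} → EdgesInside H′ → ∣ U H′ ∣ ≤ fuel′ → MarkedArc H′ (s + h) (s + m) →
            tauF fuel′ H′ ≤∞ suc ⌈log₂ r ⌉
    right {H′ = H′} inside′ ∣U′∣ a′ =
      rec (⌈n/2⌉<n m′) inside′ ∣U′∣ (subst (MarkedArc H′ (s + h)) s+m≡s+h+r a′)
    bound : tauF fuel H ≤∞ suc ⌈log₂ m ⌉
    bound with joint (s + h) ∈? M H
    ... | yes mid∈M =
      ≤∞-weaken (left inside ∣U∣≤fuel (arc-prefix a s<s+h (<⇒≤ s+h<s+m) mid∈M))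
                (s≤s (⌈log₂⌉-mono-≤ (⌈n/2⌉≤n m)))
    ... | no mid∉M with trivialWin? H
    ...   | yes won     = ≤∞-weaken (tauF-≤1 fuel H won) (s≤s z≤n)
    ...   | no  not-won =
      subst (λ l → tauF fuel H ≤∞ suc l) (sym (⌈log₂n⌉≡1+⌈log₂⌈n/2⌉⌉ m (s≤s (s≤s z≤n))))
        (split-arc-τ≤ fuel inside ∣U∣≤fuel not-won a s<s+h s+h<s+m mid∉M λ inside′ ∣U′∣ →
           λ { (inj₁ a′) → left inside′ ∣U′∣ a′ ; (inj₂ a′) → right inside′ ∣U′∣ a′ })

  arc-τ≤ : ∀ m → ArcBound m
  arc-τ≤ = <-rec ArcBound λ where
    zero _ _ _ a → ⊥-elim (<-irrefl (sym (+-identityʳ _)) (MarkedArc.s<t a))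
    1 _ {s} {fuel} {H} _ _ a → tauF-≤1 fuel H (short-arc-won (subst (MarkedArc H s) (+-comm s 1) a))
    (suc (suc m′)) rec → arc-halving m′ rec

  -- Breaker's strategy

  record Invariant (H : MH n) (k : ℕ) : Set where
    field
      edges⊆C   : ∀ f → f ∈ₗ E H → f ∈ₗ E C
      inside    : EdgesInside H
      V⊆C       : V H ⊆ V C
      pendant∉M : ∀ s → 1 ≤ s → s ≤ L → e s ∈ₗ E H → pendant s ∉ M H
      arcs-long : ∀ {s t} → MarkedArc H s t → s + k ≤ t
      a-marked  : a ∈ M H
  open Invariant

  edge-free-joint : ∀ {H k} → Invariant H k → 2 ≤ k → ∀ s → 1 ≤ s → s ≤ L → e s ∈ₗ E H →
                    joint (pred s) ∉ M H ⊎ joint s ∉ M H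
  edge-free-joint {H} {k} I 2≤k (suc s) _ s<L present with joint s ∈? M H | joint (suc s) ∈? M H
  ... | no  js∉M | _          = inj₁ js∉M
  ... | yes _    | no  js′∉M  = inj₂ js′∉M
  ... | yes js∈M | yes js′∈M  =
    ⊥-elim (<⇒≱ 2≤k (+-cancelˡ-≤ s k 1 (subst (s + k ≤_) (+-comm 1 s)
      (arcs-long I (arc ≤-refl s<L js∈M js′∈M λ r s<r r≤s+1 →
         subst (λ i → e i ∈ₗ E H) (≤-antisym s<r r≤s+1) present)))))

  Invariant⇒TwoFree : ∀ {H k} → Invariant H k → 2 ≤ k → TwoFree H
  Invariant⇒TwoFree {H} I 2≤k f f∈ with to (E-iff f) (edges⊆C I f f∈)
  ... | s , 1≤s , s≤L , refl with pendant-spec s 1≤s s≤L | edge-free-joint I 2≤k s 1≤s s≤L f∈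
  ...   | p∈ , p≢j , _  | inj₁ j∉M = 2≤∣f─M∣ p∈ (joint-pred∈e s 1≤s s≤L) p≢j (pendant∉M I s 1≤s s≤L f∈) j∉M
  ...   | p∈ , _ , p≢j′ | inj₂ j∉M = 2≤∣f─M∣ p∈ (joint∈e s 1≤s s≤L) p≢j′ (pendant∉M I s 1≤s s≤L f∈) j∉M

  arc-before-play : ∀ {H s t} x y → MarkedArc (play x y H) s t → joint s ≢ x → joint t ≢ x →
                    MarkedArc H s t
  arc-before-play {H} x y (arc s<t t≤L js∈M jt∈M edges) js≢x jt≢x =
    arc s<t t≤L (M-play⁻ H x y js∈M js≢x) (M-play⁻ H x y jt∈M jt≢x)
        λ r s<r r≤t → proj₁ (E-play⁻ H x y (edges r s<r r≤t))

  Invariant-play : ∀ {H k k′} → Invariant H k → ∀ x y → y ∈ U H →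
                   (∀ s → 1 ≤ s → s ≤ L → e s ∈ₗ E (play x y H) → pendant s ≢ x) →
                   (∀ {s t} → MarkedArc (play x y H) s t → s + k′ ≤ t) →
                   Invariant (play x y H) k′
  Invariant-play {H} I x y y∈U pendant≢x long = record
    { edges⊆C   = λ f → edges⊆C I f ∘ proj₁ ∘ E-play⁻ H x y
    ; inside    = EdgesInside-play {H = H} x y (inside I)
    ; V⊆C       = V⊆C I ∘ V-play⁻ H x y
    ; pendant∉M = λ s 1≤s s≤L present p∈M →
        pendant∉M I s 1≤s s≤L (proj₁ (E-play⁻ H x y present))
                  (M-play⁻ H x y p∈M (pendant≢x s 1≤s s≤L present))
    ; arcs-long = long
    ; a-marked  = M-play⁺ H x y (a-marked I) (u∈p∧v∉p⇒u≢v (a-marked I) (proj₂ (U⁻ H y∈U)))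
    }

  arcs-avoiding-long : ∀ {H k s t} → Invariant H k → ∀ x y → MarkedArc (play x y H) s t →
                       joint s ≢ x → joint t ≢ x → s + ⌈ k /2⌉ ≤ t
  arcs-avoiding-long {k = k} {s} I x y a js≢x jt≢x =
    ≤-trans (+-monoʳ-≤ s (⌈n/2⌉≤n k)) (arcs-long I (arc-before-play x y a js≢x jt≢x))

  pendant-killer : ∀ {H k} → Invariant H k → 2 ≤ k → 2 ≤ ∣ U H ∣ → ∀ s₀ → 1 ≤ s₀ → s₀ ≤ L →
                   ∃[ y ] (y ∈ U H × y ≢ pendant s₀ × (e s₀ ∈ₗ E H → y ∈ e s₀))
  pendant-killer {H} I 2≤k 2≤∣U∣ s₀ 1≤s₀ s₀≤L with e s₀ ∈ₗ? E H
  ... | no absent =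
    let y , y∈U , y≢x = 2≤∣p∣⇒another 2≤∣U∣ (pendant s₀) in y , y∈U , y≢x , ⊥-elim ∘ absent
  ... | yes present with pendant-spec s₀ 1≤s₀ s₀≤L | edge-free-joint I 2≤k s₀ 1≤s₀ s₀≤L present
  ...   | _ , x≢j , _ | inj₁ j∉M =
    let j∈ = joint-pred∈e s₀ 1≤s₀ s₀≤L in
    _ , U⁺ H (inside I _ present j∈) j∉M , x≢j ∘ sym , λ _ → j∈
  ...   | _ , _ , x≢j′ | inj₂ j∉M =
    let j∈ = joint∈e s₀ 1≤s₀ s₀≤L in
    _ , U⁺ H (inside I _ present j∈) j∉M , x≢j′ ∘ sym , λ _ → j∈

  answer-pendant : ∀ {H k} → Invariant H k → 2 ≤ k → 2 ≤ ∣ U H ∣ → ∀ s₀ → 1 ≤ s₀ → s₀ ≤ L →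
                   ∃[ y ] (y ∈ U H × y ≢ pendant s₀ × Invariant (play (pendant s₀) y H) ⌈ k /2⌉)
  answer-pendant {H} I 2≤k 2≤∣U∣ s₀ 1≤s₀ s₀≤L with pendant-killer I 2≤k 2≤∣U∣ s₀ 1≤s₀ s₀≤L
  ... | y , y∈U , y≢x , kills =
    y , y∈U , y≢x , Invariant-play I x y y∈U pendant≢x λ a →
      arcs-avoiding-long I x y a (joint≢pendant (arc-start≤L a) 1≤s₀ s₀≤L)
                                 (joint≢pendant (MarkedArc.t≤L a) 1≤s₀ s₀≤L)
    where
    x : Fin n
    x = pendant s₀
    pendant≢x : ∀ s → 1 ≤ s → s ≤ L → e s ∈ₗ E (play x y H) → pendant s ≢ x
    pendant≢x s 1≤s s≤L present p≡x
      with pendant-private 1≤s₀ s₀≤L 1≤s s≤L (subst (_∈ e s) p≡x (proj₁ (pendant-spec s 1≤s s≤L)))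
    ... | refl = let present-before , y∉e = E-play⁻ H x y present in y∉e (kills present-before)

  LeftOf RightOf : MH n → ℕ → ℕ → Set
  LeftOf  H t s = s < t × joint s ∈ M H × EdgesPresent H s t
  RightOf H t u = t < u × u ≤ L × joint u ∈ M H × EdgesPresent H t u

  edgesPresent? : ∀ H s t → Dec (EdgesPresent H s t)
  edgesPresent? H s t =
    map′ (λ all r s<r r≤t → all (s≤s r≤t) s<r) (λ all {r} r<1+t s<r → all r s<r (≤-pred r<1+t))
         (allUpTo? {P = λ r → s < r → e r ∈ₗ E H} (λ r → (s <? r) →-dec (e r ∈ₗ? E H)) (suc t))

  leftOf? : ∀ H t s → Dec (LeftOf H t s)
  leftOf? H t s = (s <? t) ×-dec ((joint s ∈? M H) ×-dec edgesPresent? H s t)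

  rightOf? : ∀ H t u → Dec (RightOf H t u)
  rightOf? H t u = (t <? u) ×-dec ((u ≤? L) ×-dec ((joint u ∈? M H) ×-dec edgesPresent? H t u))

  join-arcs : ∀ {H t s u} → LeftOf H t s → RightOf H t u → MarkedArc H s u
  join-arcs {H} {t} {s} {u} (s<t , js∈M , left) (t<u , u≤L , ju∈M , right) =
    arc (<-trans s<t t<u) u≤L js∈M ju∈M edges
    where
    edges : EdgesPresent H s u
    edges r s<r r≤u with r ≤? t
    ... | yes r≤t = left r s<r r≤t
    ... | no  r≰t = right r (≰⇒> r≰t) r≤u

  joint≡⇒≡ : ∀ {t u} → 1 ≤ t → t < L → u ≤ L → joint u ≡ joint t → u ≡ t
  joint≡⇒≡ {t} {u} 1≤t t<L u≤L ju≡jt with <-cmp u t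
  ... | tri≈ _ u≡t _ = u≡t
  ... | tri< u<t _ _ = ⊥-elim (<-irrefl (proj₂ (joint-injective u<t (<⇒≤ t<L) ju≡jt)) t<L)
  ... | tri> _ _ t<u = ⊥-elim (<-irrefl (sym (proj₁ (joint-injective t<u u≤L (sym ju≡jt)))) 1≤t)

  module _ {H : MH n} {t : ℕ} (1≤t : 1 ≤ t) (t<L : t < L) (y : Fin n) where

    private
      x : Fin n
      x = joint t
      H′ : MH n
      H′ = play x y H

    arc-from-played : ∀ {u} → MarkedArc H′ t u → RightOf H t u
    arc-from-played (arc t<u u≤L _ ju∈M edges) =
      t<u , u≤L , M-play⁻ H x y ju∈M (λ ju≡x → <-irrefl (sym (joint≡⇒≡ 1≤t t<L u≤L ju≡x)) t<u) ,
      λ r t<r r≤u → proj₁ (E-play⁻ H x y (edges r t<r r≤u))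

    arc-into-played : ∀ {s} → MarkedArc H′ s t → joint s ≢ x → LeftOf H t s
    arc-into-played (arc s<t _ js∈M _ edges) js≢x =
      s<t , M-play⁻ H x y js∈M js≢x , λ r s<r r≤t → proj₁ (E-play⁻ H x y (edges r s<r r≤t))

    Invariant-after-joint : ∀ {k} → Invariant H k → y ∈ U H →
                            (∀ {u} → MarkedArc H′ t u → t + ⌈ k /2⌉ ≤ u) →
                            (∀ {s} → MarkedArc H′ s t → joint s ≢ x → s + ⌈ k /2⌉ ≤ t) →
                            Invariant H′ ⌈ k /2⌉
    Invariant-after-joint {k} I y∈U from-t into-t =
      Invariant-play I x y y∈U (λ s 1≤s s≤L _ p≡x → joint≢pendant (<⇒≤ t<L) 1≤s s≤L (sym p≡x)) long
      where
      long : ∀ {s′ t′} → MarkedArc H′ s′ t′ → s′ + ⌈ k /2⌉ ≤ t′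
      long {s′} {t′} a with joint s′ ≟ᶠ x | joint t′ ≟ᶠ x
      ... | yes js≡x | _ with joint≡⇒≡ 1≤t t<L (arc-start≤L a) js≡x
      ...   | refl = from-t a
      long {s′} {t′} a | no js≢x | yes jt≡x with joint≡⇒≡ 1≤t t<L (MarkedArc.t≤L a) jt≡x
      ...   | refl = into-t a js≢x
      long a | no js≢x | no jt≢x = arcs-avoiding-long I x y a js≢x jt≢x

  module _ {H : MH n} {k t : ℕ} (I : Invariant H k) (1≤t : 1 ≤ t) (t<L : t < L) where

    private
      x : Fin n
      x = joint t

    Answer : Set
    Answer = ∃[ y ] (y ∈ U H × y ≢ x × Invariant (play x y H) ⌈ k /2⌉)

    cut-left : ∀ {s₀} → LeftOf H t s₀ → (∀ {u} → RightOf H t u → t + ⌈ k /2⌉ ≤ u) → Answer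
    cut-left (s₀<t , _ , left) long-right =
      y , y∈U , y≢x ,
      Invariant-after-joint 1≤t t<L y I y∈U (long-right ∘ arc-from-played 1≤t t<L y) λ a _ → ⊥-elim (dead a)
      where
      y : Fin n
      y = pendant t
      present : e t ∈ₗ E H
      present = left t s₀<t ≤-refl
      y∈e : y ∈ e t
      y∈e = proj₁ (pendant-spec t 1≤t (<⇒≤ t<L))
      y≢x : y ≢ x
      y≢x = proj₂ (proj₂ (pendant-spec t 1≤t (<⇒≤ t<L)))
      y∈U : y ∈ U H
      y∈U = U⁺ H (inside I _ present y∈e) (pendant∉M I t 1≤t (<⇒≤ t<L) present)
      dead : ∀ {s} → MarkedArc (play x y H) s t → ⊥
      dead a = proj₂ (E-play⁻ H x y (MarkedArc.edges a t (MarkedArc.s<t a) ≤-refl)) y∈e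

    cut-right : ∀ {u₀} → RightOf H t u₀ → (∀ {s} → LeftOf H t s → s + ⌈ k /2⌉ ≤ t) → Answer
    cut-right (t<u₀ , _ , _ , right) long-left =
      y , y∈U , y≢x ,
      Invariant-after-joint 1≤t t<L y I y∈U (λ a → ⊥-elim (dead a))
                            λ a js≢x → long-left (arc-into-played 1≤t t<L y a js≢x)
      where
      y : Fin n
      y = pendant (suc t)
      present : e (suc t) ∈ₗ E H
      present = right (suc t) ≤-refl t<u₀
      y∈e : y ∈ e (suc t)
      y∈e = proj₁ (pendant-spec (suc t) (s≤s z≤n) t<L)
      y≢x : y ≢ x
      y≢x = proj₁ (proj₂ (pendant-spec (suc t) (s≤s z≤n) t<L))
      y∈U : y ∈ U H
      y∈U = U⁺ H (inside I _ present y∈e) (pendant∉M I (suc t) (s≤s z≤n) t<L present)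
      dead : ∀ {u} → MarkedArc (play x y H) t u → ⊥
      dead a = proj₂ (E-play⁻ H x y (MarkedArc.edges a (suc t) ≤-refl (MarkedArc.s<t a))) y∈e

    isolated : 2 ≤ ∣ U H ∣ → (∀ s → ¬ LeftOf H t s) → (∀ u → ¬ RightOf H t u) → Answer
    isolated 2≤∣U∣ no-left no-right =
      let y , y∈U , y≢x = 2≤∣p∣⇒another 2≤∣U∣ x in
      y , y∈U , y≢x ,
      Invariant-after-joint 1≤t t<L y I y∈U (λ a → ⊥-elim (no-right _ (arc-from-played 1≤t t<L y a)))
                            λ a js≢x → ⊥-elim (no-left _ (arc-into-played 1≤t t<L y a js≢x))

    answer-joint : 2 ≤ ∣ U H ∣ → Answer
    answer-joint 2≤∣U∣ with greatest (leftOf? H t) t (λ _ → proj₁)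
                          | least (rightOf? H t) (suc L) (λ _ r → s≤s (proj₁ (proj₂ r)))
    ... | inj₁ (sm , Lsm , max) | inj₁ (um , Rum , min) with t + t ≤? sm + um
    ...   | yes nearer-left = cut-left Lsm λ Ru →
      half-gap-right (<⇒≤ (proj₁ Ru)) (arcs-long I (join-arcs Lsm Ru))
                     (≤-trans nearer-left (+-monoʳ-≤ sm (min _ Ru)))
    ...   | no  nearer-right = cut-right Rum λ Ls →
      half-gap-left (<⇒≤ (proj₁ Ls)) (arcs-long I (join-arcs Ls Rum))
                    (≤-trans (+-monoʳ-≤ um (max _ Ls))
                             (≤-trans (≤-reflexive (+-comm um sm)) (<⇒≤ (≰⇒> nearer-right))))
    answer-joint 2≤∣U∣ | inj₁ (_ , Lsm , _) | inj₂ no-right = cut-left Lsm λ Ru → ⊥-elim (no-right _ Ru)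
    answer-joint 2≤∣U∣ | inj₂ no-left | inj₁ (_ , Rum , _) = cut-right Rum λ Ls → ⊥-elim (no-left _ Ls)
    answer-joint 2≤∣U∣ | inj₂ no-left | inj₂ no-right = isolated 2≤∣U∣ no-left no-right

  answer : ∀ {H k} → Invariant H k → 2 ≤ k → ∀ x → x ∈ U H → 2 ≤ ∣ U H ∣ →
           ∃[ y ] (y ∈ U H × y ≢ x × Invariant (play x y H) ⌈ k /2⌉)
  answer {H} I 2≤k x x∈U 2≤∣U∣ with U⁻ H x∈U
  ... | x∈V , x∉M with vertex-kind (V⊆C I x∈V)
  ...   | inj₂ (s , 1≤s , s≤L , refl) = answer-pendant I 2≤k 2≤∣U∣ s 1≤s s≤L
  ...   | inj₁ (t , t≤L , refl) = answer-joint I 1≤t t<L 2≤∣U∣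
    where
    1≤t : 1 ≤ t
    1≤t = ≤∧≢⇒< z≤n λ { refl → x∉M (subst (_∈ M H) (sym joint-0) (a-marked I)) }
    t<L : t < L
    t<L = ≤∧≢⇒< t≤L λ { refl → x∉M (subst (_∈ M H) (sym joint-L) (a-marked I)) }

  Invariant-τ≥ : ∀ fuel k {H} → 2 ≤ k → Invariant H k → tauF fuel H ≥∞ suc ⌈log₂ k ⌉
  Invariant-τ≥ zero k {H} 2≤k I = tauF-zero-≥ _ H (Invariant⇒TwoFree I 2≤k)
  Invariant-τ≥ (suc fuel) k {H} 2≤k I with k ≟ 2
  ... | yes refl = tauF-play-≥ fuel 1 H (Invariant⇒TwoFree I 2≤k) λ x _ 2≤∣U∣ →
    let y , y∈U , y≢x = 2≤∣p∣⇒another 2≤∣U∣ x in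
    y , y∈U , y≢x , tauF-≥1 fuel _ (play-keeps-free-vertex {H = H} (Invariant⇒TwoFree I 2≤k) x y)
  ... | no k≢2 = subst (λ l → tauF (suc fuel) H ≥∞ suc l) (sym (⌈log₂n⌉≡1+⌈log₂⌈n/2⌉⌉ k 2≤k))
    (tauF-play-≥ fuel _ H (Invariant⇒TwoFree I 2≤k) λ x x∈U 2≤∣U∣ →
      let y , y∈U , y≢x , I′ = answer I 2≤k x x∈U 2≤∣U∣ in
      y , y∈U , y≢x , Invariant-τ≥ fuel ⌈ k /2⌉ 2≤⌈k/2⌉ I′)
    where
    2≤⌈k/2⌉ : 2 ≤ ⌈ k /2⌉
    2≤⌈k/2⌉ = ⌈n/2⌉-mono {3} (≤∧≢⇒< 2≤k (k≢2 ∘ sym))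

  only-arc : ∀ {s t} → MarkedArc C s t → s ≡ 0 × t ≡ L
  only-arc (arc s<t t≤L js∈M jt∈M _) =
    joint-injective s<t t≤L (trans (marked⇒a (joint∈V _ (<⇒≤ (<-≤-trans s<t t≤L))) js∈M)
                                   (sym (marked⇒a (joint∈V _ t≤L) jt∈M)))

  Invariant-C : Invariant C L
  Invariant-C = record
    { edges⊆C   = λ _ f∈ → f∈
    ; inside    = E⊆V
    ; V⊆C       = λ v∈ → v∈
    ; pendant∉M = λ s 1≤s s≤L _ p∈M →
        pendant≢a 1≤s s≤L (marked⇒a (e⊆V 1≤s s≤L (proj₁ (pendant-spec s 1≤s s≤L))) p∈M)
    ; arcs-long = long
    ; a-marked  = a∈M
    }
    where
    long : ∀ {s t} → MarkedArc C s t → s + L ≤ t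
    long a with only-arc a
    ... | refl , refl = ≤-refl

  -- Snakes

  snake : ∀ {k ε x} → IsPath (spanned C k ε) ε k x a → (∀ i → 1 ≤ i → i ≤ k → ε i ∈ₗ E C) →
          x ∉ M C → InXS C x (spanned C k ε)
  snake {k} {ε} {x} path@(1≤k , ∣ε∣≡3 , _ , _ , _ , _ , _ , x∈ε₁ , _ , a∈εk , _) in-C x∉M =
    sub , from (V-spanned C k ε x) (1 , ≤-refl , 1≤k , x∈ε₁) , x∉M ∘ proj₂ ∘ x∈p∩q⁻ _ _ ,
    k , ε , a , path , x∈p∩q⁺ (from (V-spanned C k ε a) (k , 1≤k , ≤-refl , a∈εk) , a∈M) , only-a
    where
    X : MH n
    X = spanned C k ε
    sub : IsSub X C
    sub = spanned-sub C k ε 1≤k E⊆V λ i 1≤i i≤k →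
      in-C i 1≤i i≤k , 1≤∣p∣⇒nonempty (≤-trans (s≤s z≤n) (≤-reflexive (sym (∣ε∣≡3 i 1≤i i≤k))))
    only-a : ∀ v → v ∈ V X → v ∈ M X → v ≡ a
    only-a v v∈ v∈M = let i , 1≤i , i≤k , v∈ε = to (V-spanned C k ε v) v∈ in
      marked⇒a (E⊆V _ (in-C i 1≤i i≤k) v∈ε) (proj₂ (x∈p∩q⁻ _ _ v∈M))

  x₀ : Fin n
  x₀ = joint 1

  x₀∉M : x₀ ∉ M C
  x₀∉M x₀∈M = joint≢a 1 ≤-refl 2≤L (marked⇒a (joint∈V 1 1≤L) x₀∈M)

  short-snake : InXS C x₀ (spanned C 1 (λ _ → e 1))
  short-snake = snake
    ( ≤-refl , (λ _ _ _ → ∣e∣≡3 1 ≤-refl 1≤L) , V-spanned C 1 _ , E-spanned C 1 _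
    , (λ _ 1≤i i<1 → ⊥-elim (<⇒≱ i<1 1≤i))
    , (λ i _ _ i+2≤j j≤1 → ⊥-elim (1+n≰n (≤-trans (m≤n+m 2 i) (≤-trans i+2≤j j≤1))))
    , joint≢a 1 ≤-refl 2≤L , joint∈e 1 ≤-refl 1≤L , (λ _ 2≤i i≤1 → ⊥-elim (<⇒≱ 2≤i i≤1))
    , a∈e₁ , (λ _ 1≤i i<1 → ⊥-elim (<⇒≱ i<1 1≤i)) )
    (λ _ _ _ → e∈E ≤-refl 1≤L) x₀∉M

  K : ℕ
  K = L ∸ 1

  1+i≤L : ∀ {i} → i ≤ K → suc i ≤ L
  1+i≤L i≤K = subst (_ ≤_) (m+[n∸m]≡n 1≤L) (s≤s i≤K)

  long-snake : InXS C x₀ (spanned C K (e ∘ suc))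
  long-snake = snake
    ( ≤-pred 2≤1+K , (λ i _ i≤K → ∣e∣≡3 (suc i) (s≤s z≤n) (1+i≤L i≤K))
    , V-spanned C K _ , E-spanned C K _
    , (λ i 1≤i i<K → proj₁ (longCycle (≤-trans (s≤s (s≤s 1≤i)) (1+i≤L i<K))) (suc i) (s≤s z≤n) (1+i≤L i<K))
    , (λ i j 1≤i i+2≤j j≤K →
         proj₂ (proj₂ (longCycle (≤-trans (s≤s (≤-trans (m≤n+m 2 i) i+2≤j)) (1+i≤L j≤K))))
           (suc i) (suc j) (s≤s z≤n) (s≤s i+2≤j) (1+i≤L j≤K)
           λ (1+i≡1 , _) → <⇒≢ 1≤i (sym (suc-injective 1+i≡1)))
    , joint≢a 1 ≤-refl 2≤L , joint∈e-suc 1 2≤L , x₀∉far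
    , subst (λ l → a ∈ e l) (sym (m+[n∸m]≡n 1≤L)) a∈eL
    , (λ i 1≤i i<K → a∉e (suc i) (s≤s 1≤i) (1+i≤L i<K)) )
    (λ i _ i≤K → e∈E (s≤s z≤n) (1+i≤L i≤K)) x₀∉M
    where
    2≤1+K : 2 ≤ suc K
    2≤1+K = subst (2 ≤_) (sym (m+[n∸m]≡n 1≤L)) 2≤L
    x₀∉far : ∀ i → 2 ≤ i → i ≤ K → x₀ ∉ e (suc i)
    x₀∉far i 2≤i i≤K x₀∈
      with shared-vertex ≤-refl (s≤s (≤-trans (s≤s z≤n) 2≤i)) (1+i≤L i≤K) (joint∈e 1 ≤-refl 1≤L) x₀∈
    ... | inj₁ (1+i≡2 , _)  = <⇒≢ 2≤i (sym (suc-injective 1+i≡2))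
    ... | inj₂ (_ , _ , x₀≡a) = joint≢a 1 ≤-refl 2≤L x₀≡a

  ¬J1 : ¬ J1 C
  ¬J1 j1 with j1 x₀ (U⁺ C (joint∈V 1 1≤L) x₀∉M)
  ... | v , v∈U , in-every-snake
    with to (V-spanned C 1 _ v) (in-every-snake _ short-snake)
       | to (V-spanned C K (e ∘ suc) v) (in-every-snake _ long-snake)
  ... | _ , _ , _ , v∈e₁ | i , 1≤i , i≤K , v∈e with shared-vertex ≤-refl (s≤s 1≤i) (1+i≤L i≤K) v∈e₁ v∈e
  ...   | inj₁ (_ , refl)     = proj₂ (U⁻ (mark x₀ C) v∈U) (x∈p[x]≔true x₀ (M C))
  ...   | inj₂ (_ , _ , refl) = proj₂ (U⁻ (mark x₀ C) v∈U) (x∈p⇒x∈p[y]≔true x₀ (M C) a∈M)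

  whole-arc : MarkedArc C 0 L
  whole-arc = arc 1≤L ≤-refl (subst (_∈ M C) (sym joint-0) a∈M) (subst (_∈ M C) (sym joint-L) a∈M)
                  λ r 0<r r≤L → e∈E 0<r r≤L

mainTheorem11 : ∀ {n} (C : MH n) (e : ℕ → Subset n) (L : ℕ) (a : Fin n) →
    WF C → IsNecklace C e L a →
    MakerWin C × τM C ≡ just (1 + ⌈log₂ L ⌉) × ¬ J1 C
mainTheorem11 C e L a _
  ((2≤L , ∣e∣≡3 , V-iff , E-iff , a∈e₁ , a∈eL , a∉e , twoEdges , longCycle) , M-iff) =
  tauF-finite⇒MakerWin _ _ C upper , ≤∞-≥∞⇒≡ upper lower , ¬J1
  where
  open Necklace C e L a 2≤L ∣e∣≡3 V-iff E-iff a∈e₁ a∈eL a∉e twoEdges longCycle M-iff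
  upper : τM C ≤∞ suc ⌈log₂ L ⌉
  upper = arc-τ≤ L E⊆V ≤-refl whole-arc
  lower : τM C ≥∞ suc ⌈log₂ L ⌉
  lower = Invariant-τ≥ ∣ U C ∣ L 2≤L Invariant-C
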